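{- Let $p$ be a prime and let $L$ be the free Lie algebra over $\mathbb{F}_p$ on $\xi_1,\ldots,\xi_d$, graded with each $\xi_i$ of degree $1$. Let $A,B$ be a partition of $\{1,\ldots,d\}$ into non-empty sets, and let $\mathfrak{s}$ be the ideal of $L$ generated by $\{\xi_j: j\in B\}$. Let $\rho_1,\ldots,\rho_m\in\mathfrak{s}$ be elements of the form $$\rho_k=\sum_{1\le i<j\le d}\overline a_{ijk}[\xi_i,\xi_j],\qquad \overline a_{ijk}\in\mathbb{F}_p .$$ Let $M_L$ be the $m\times (|A|\,|B|)$ matrix over $\mathbb{F}_p$ whose rows are indexed by $k$, whose columns are indexed by the pairs $(a,b)$ with $a\in A$, $b\in B$, and whose entry in row $k$ and column $(a,b)$ is $\overline a_{\min(a,b),\max(a,b),k}$. Suppose that (a) $\overline a_{ijk}=0$ whenever $i,j\in A$, and (b) the rank of $M_L$ is $m$. Then the sequence $\rho_1,\ldots,\rho_m$ is strongly free in $L$. -}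

module Defs where

open import Data.Nat as ℕ using (ℕ; zero; suc)
open import Data.Integer using (ℤ; +_; _+_; _*_; _-_)
open import Data.Integer.Divisibility using (_∣_)
open import Data.Fin using (Fin; toℕ; _<?_)
open import Data.Fin.Properties renaming (_≟_ to _≟ᶠ_)
open import Data.Vec using (Vec; take; drop; head; tail)
open import Data.Vec.Properties using (≡-dec)
open import Data.List using (List; foldr)
open import Data.Product using (Σ; ∃; _×_; _,_)
open import Data.Bool using (Bool; true; false; if_then_else_)
open import Relation.Nullary using (does)
open import Relation.Binary.PropositionalEquality using (_≡_; subst; sym)

-- 𝔽_p is modelled as ℤ with equality taken modulo p.

infix 4 _≡[mod_]_
_≡[mod_]_ : ℤ → ℕ → ℤ → Set
x ≡[mod p ] y = (+ p) ∣ (x - y)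

∑ : (n : ℕ) → (Fin n → ℤ) → ℤ
∑ zero    f = + 0
∑ (suc n) f = f Fin.zero + ∑ n (λ i → f (Fin.suc i))

-- Data: d generators ξ₁..ξ_d, m relators, coefficients ā_{ijk}
-- (only the values with i < j are ever used).

Coeffs : ℕ → ℕ → Set
Coeffs d m = Fin d → Fin d → Fin m → ℤ

when< : {d : ℕ} → Fin d → Fin d → ℤ → ℤ
when< i j z = if does (i <? j) then z else + 0

-- ρ_k = Σ_{i<j} ā_{ijk} [ξ_i, ξ_j] viewed in U(L) = 𝔽_p⟨ξ₁..ξ_d⟩
-- (the free associative algebra), where [ξ_i,ξ_j] = ξ_iξ_j − ξ_jξ_i.
-- Coefficient of the degree-2 word ξ_x ξ_y in ρ_k:
ρcoef : {d m : ℕ} → Coeffs d m → Fin m → Fin d → Fin d → ℤ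
ρcoef a k x y = when< x y (a x y k) - when< y x (a y x k)

-- Degree-n homogeneous component of 𝔽_p⟨ξ₁..ξ_d⟩:
-- functions from words of length n to coefficients.
Word : ℕ → ℕ → Set
Word d n = Vec (Fin d) n

Hom : ℕ → ℕ → Set
Hom d n = Word d n → ℤ

ind : {d n : ℕ} → Word d n → Word d n → ℤ
ind u u' = if does (≡-dec _≟ᶠ_ u u') then + 1 else + 0

-- The element  u · ρ_k · v  (u, v words), of degree a + (2 + b).
gen : {d m : ℕ} → Coeffs d m → (a b : ℕ) → Word d a → Word d b → Fin m →
      Hom d (a ℕ.+ (2 ℕ.+ b))
gen cf a b u v k w =
  let rest = drop a w in
  ind u (take a w) * (ρcoef cf k (head rest) (head (tail rest)) * ind v (drop 2 rest))

record Term (d m n : ℕ) : Set where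
  constructor term
  field
    a b  : ℕ
    deg  : a ℕ.+ (2 ℕ.+ b) ≡ n
    u    : Word d a
    v    : Word d b
    k    : Fin m
    c    : ℤ

evalTerm : {d m n : ℕ} → Coeffs d m → Term d m n → Hom d n
evalTerm cf (term a b deg u v k c) w =
  c * gen cf a b u v k (subst (Vec _) (sym deg) w)

evalTerms : {d m n : ℕ} → Coeffs d m → List (Term d m n) → Hom d n
evalTerms cf ts w = foldr (λ t s → evalTerm cf t w + s) (+ 0) ts

InIdeal : (p : ℕ) {d m n : ℕ} → Coeffs d m → Hom d n → Set
InIdeal p {d} {m} {n} cf f =
  Σ (List (Term d m n)) λ ts → ∀ w → f w ≡[mod p ] evalTerms cf ts w

lincomb : {d n r : ℕ} → (Fin r → ℤ) → (Fin r → Hom d n) → Hom d n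
lincomb {r = r} c e w = ∑ r (λ i → c i * e i w)

QuotDim : (p : ℕ) {d m : ℕ} → Coeffs d m → (n r : ℕ) → Set
QuotDim p {d} {m} cf n r =
  Σ (Fin r → Hom d n) λ e →
    (∀ (c : Fin r → ℤ) → InIdeal p cf (lincomb c e) → ∀ i → c i ≡[mod p ] + 0)
  × (∀ (f : Hom d n) → ∃ λ (c : Fin r → ℤ) →
       InIdeal p cf (λ w → f w - lincomb c e w))

-- coefficients of (1 − d t + m t²)⁻¹
hilb : ℕ → ℕ → ℕ → ℤ
hilb d m zero = + 1
hilb d m (suc zero) = + d
hilb d m (suc (suc n)) = (+ d) * hilb d m (suc n) - (+ m) * hilb d m n

-- ρ₁,…,ρ_m (all of degree 2) is strongly free in the free Lie algebra L:
-- U(L/(ρ)) = 𝔽_p⟨ξ⟩/(ρ) has Hilbert series (1 − d t + m t²)⁻¹.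
StronglyFree : (p d m : ℕ) → Coeffs d m → Set
StronglyFree p d m cf =
  ∀ n → ∃ λ r → (hilb d m n ≡ + r) × QuotDim p cf n r

-- The matrix M_L: rows k, columns (a,b) with a ∈ A, b ∈ B, entry
-- ā_{min(a,b),max(a,b),k}.  A is given by inA (B = complement).

entryML : {d m : ℕ} → Coeffs d m → Fin m → Fin d → Fin d → ℤ
entryML cf k i j = if does (i <? j) then cf i j k else cf j i k

-- rank M_L = m, i.e. the m rows of M_L are linearly independent over 𝔽_p.
FullRowRank : (p : ℕ) {d m : ℕ} → (Fin d → Bool) → Coeffs d m → Set
FullRowRank p {d} {m} inA cf =
  ∀ (c : Fin m → ℤ) →
    (∀ i j → inA i ≡ true → inA j ≡ false →
       ∑ m (λ k → c k * entryML cf k i j) ≡[mod p ] + 0) →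
    ∀ k → c k ≡[mod p ] + 0

{-# OPTIONS --safe #-}
module Submission where

-- Gaussian elimination on M_L yields a basis of the span of the ρ_k whose
-- elements have distinct "pivot" words ξ_a ξ_b (a ∈ A, b ∈ B) with
-- coefficient 1 and vanish at each other's pivots.  Rewriting every pivot
-- word into the remaining terms of its basis element gives a normal form map
-- NF on 𝔽_p⟨ξ⟩ that fixes the words containing no pivot word and, thanks to
-- hypothesis (a), vanishes on the ideal (ρ); so the normal words of length n
-- are a basis of the degree-n part of the quotient.  A pivot word starts in A
-- and ends in B, so two pivot words never overlap, and the number h_n of
-- normal words satisfies h_{n+2} = d h_{n+1} - m h_n: the coefficients of
-- (1 - d t + m t²)⁻¹.

open import Defs
open import Data.Nat as ℕ using (ℕ; zero; suc)
import Data.Nat.Properties as ℕ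
open import Data.Nat.Primality using (Prime; prime⇒irreducible; prime⇒nonTrivial)
open import Data.Nat.Coprimality using (Coprime; coprime-Bézout)
open import Data.Nat.GCD using (module Bézout)
import Data.Nat.Divisibility as ℕDiv
open import Data.Integer using (ℤ; +_; -[1+_]; _+_; _*_; _-_; -_; ∣_∣)
open import Data.Integer.Properties hiding (_<?_)
open import Data.Integer.Tactic.RingSolver using (solve-∀)
import Data.Integer.Divisibility.Signed as Signed
open import Data.Fin using (Fin; toℕ; _<_; _<?_)
import Data.Fin.Properties as FinP
open FinP using () renaming (_≟_ to _≟ᶠ_)
import Data.Bool.Properties as Boolₚ
open import Data.Vec using (Vec; []; _∷_; _++_; head; tail; take; drop)
open import Data.List as List using (List; []; _∷_) renaming (_++_ to _++ᴸ_)
import Data.List.Properties as List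
import Data.List.Relation.Unary.All as All
import Data.List.Relation.Unary.AllPairs as AllPairs
open import Data.List.Relation.Unary.Unique.Propositional using (Unique)
import Data.List.Relation.Unary.Unique.Propositional.Properties as Uniqueₚ
open import Data.List.Membership.Propositional.Properties using (∈-filter⁻; ∈-lookup)
open import Data.Vec.Properties using (≡-dec; ∷-injective; ++-injectiveˡ; ++-injectiveʳ; take++drop≡id)
open import Data.Vec.Functional using () renaming (_∷_ to _∷ᶠ_)
open import Data.Bool using (Bool; true; false; if_then_else_; not; _∧_; T)
open import Data.Product using (Σ; ∃; _×_; _,_; proj₁; proj₂)
open import Data.Sum using (_⊎_; inj₁; inj₂)
open import Data.Empty using (⊥-elim)
open import Relation.Nullary using (¬_; Dec; yes; no; does)
open import Relation.Nullary.Decidable using (dec-true; dec-false; _×-dec_; ¬?)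
open import Function using (_∘_)
open import Relation.Binary.Bundles using (Setoid)
open import Relation.Binary.PropositionalEquality
import Relation.Binary.Reasoning.Setoid

true≢false : true ≢ false
true≢false ()

take-++ : ∀ {A : Set} {a b} (u : Vec A a) (r : Vec A b) → take a (u ++ r) ≡ u
take-++ {a = a} u r = ++-injectiveˡ (take a (u ++ r)) u (take++drop≡id a (u ++ r))

drop-++ : ∀ {A : Set} {a b} (u : Vec A a) (r : Vec A b) → drop a (u ++ r) ≡ r
drop-++ {a = a} u r = ++-injectiveʳ (take a (u ++ r)) u (take++drop≡id a (u ++ r))

module Sums where

  ∑-cong : ∀ n {f g : Fin n → ℤ} → (∀ i → f i ≡ g i) → ∑ n f ≡ ∑ n g
  ∑-cong zero    f≗g = refl
  ∑-cong (suc n) f≗g = cong₂ _+_ (f≗g Fin.zero) (∑-cong n (f≗g ∘ Fin.suc))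

  ∑-0 : ∀ n → ∑ n (λ _ → + 0) ≡ + 0
  ∑-0 zero    = refl
  ∑-0 (suc n) = trans (+-identityˡ _) (∑-0 n)

  ∑-+ : ∀ n (f g : Fin n → ℤ) → ∑ n (λ i → f i + g i) ≡ ∑ n f + ∑ n g
  ∑-+ zero    f g = refl
  ∑-+ (suc n) f g = begin
    f₀ + g₀ + ∑ n (λ i → f (Fin.suc i) + g (Fin.suc i))
      ≡⟨ cong (_+_ (f₀ + g₀)) (∑-+ n (f ∘ Fin.suc) (g ∘ Fin.suc)) ⟩
    f₀ + g₀ + (∑ n (f ∘ Fin.suc) + ∑ n (g ∘ Fin.suc))
      ≡⟨ +-middle f₀ g₀ _ _ ⟩
    f₀ + ∑ n (f ∘ Fin.suc) + (g₀ + ∑ n (g ∘ Fin.suc)) ∎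
    where
    open ≡-Reasoning
    f₀ = f Fin.zero
    g₀ = g Fin.zero
    +-middle : ∀ a b c d → a + b + (c + d) ≡ a + c + (b + d)
    +-middle = solve-∀

  ∑-*ˡ : ∀ n c (f : Fin n → ℤ) → c * ∑ n f ≡ ∑ n (λ i → c * f i)
  ∑-*ˡ zero    c f = *-zeroʳ c
  ∑-*ˡ (suc n) c f = trans (*-distribˡ-+ c _ _) (cong (_+_ (c * f Fin.zero)) (∑-*ˡ n c (f ∘ Fin.suc)))

  ∑-*ʳ : ∀ n (f : Fin n → ℤ) c → ∑ n f * c ≡ ∑ n (λ i → f i * c)
  ∑-*ʳ n f c = trans (*-comm (∑ n f) c) (trans (∑-*ˡ n c f) (∑-cong n (λ i → *-comm c (f i))))

  ∑-neg : ∀ n (f : Fin n → ℤ) → ∑ n (λ i → - f i) ≡ - ∑ n f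
  ∑-neg n f = begin
    ∑ n (λ i → - f i)        ≡⟨ ∑-cong n (λ i → sym (-1*i≡-i (f i))) ⟩
    ∑ n (λ i → - + 1 * f i)  ≡⟨ sym (∑-*ˡ n (- + 1) f) ⟩
    - + 1 * ∑ n f            ≡⟨ -1*i≡-i _ ⟩
    - ∑ n f                  ∎
    where open ≡-Reasoning

  ∑-- : ∀ n (f g : Fin n → ℤ) → ∑ n (λ i → f i - g i) ≡ ∑ n f - ∑ n g
  ∑-- n f g = trans (∑-+ n f (λ i → - g i)) (cong (_+_ (∑ n f)) (∑-neg n g))

  ∑-const : ∀ n c → ∑ n (λ _ → c) ≡ + n * c
  ∑-const zero    c = sym (*-zeroˡ c)
  ∑-const (suc n) c = begin
    c + ∑ n (λ _ → c)  ≡⟨ cong (_+_ c) (∑-const n c) ⟩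
    c + + n * c        ≡⟨ cong (_+ + n * c) (sym (*-identityˡ c)) ⟩
    + 1 * c + + n * c  ≡⟨ sym (*-distribʳ-+ c (+ 1) (+ n)) ⟩
    + suc n * c        ∎
    where open ≡-Reasoning

  ∑-swap : ∀ n k (f : Fin n → Fin k → ℤ) →
           ∑ n (λ i → ∑ k (f i)) ≡ ∑ k (λ j → ∑ n (λ i → f i j))
  ∑-swap zero    k f = sym (∑-0 k)
  ∑-swap (suc n) k f =
    trans (cong (_+_ (∑ k (f Fin.zero))) (∑-swap n k (f ∘ Fin.suc)))
          (sym (∑-+ k (f Fin.zero) (λ j → ∑ n (λ i → f (Fin.suc i) j))))

  𝟙 : ∀ {a} {A : Set a} → Dec A → ℤ
  𝟙 a? = if does a? then + 1 else + 0

  𝟙-yes : ∀ {a} {A : Set a} (a? : Dec A) → A → 𝟙 a? ≡ + 1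
  𝟙-yes a? a rewrite dec-true a? a = refl

  𝟙-no : ∀ {a} {A : Set a} (a? : Dec A) → ¬ A → 𝟙 a? ≡ + 0
  𝟙-no a? ¬a rewrite dec-false a? ¬a = refl

  δ : ∀ {n} → Fin n → Fin n → ℤ
  δ i j = 𝟙 (i ≟ᶠ j)

  δ-refl : ∀ {n} (i : Fin n) → δ i i ≡ + 1
  δ-refl i = 𝟙-yes (i ≟ᶠ i) refl

  δ-≢ : ∀ {n} {i j : Fin n} → i ≢ j → δ i j ≡ + 0
  δ-≢ {i = i} {j} = 𝟙-no (i ≟ᶠ j)

  δ-sym : ∀ {n} (i j : Fin n) → δ i j ≡ δ j i
  δ-sym i j with i ≟ᶠ j
  ... | yes refl = sym (δ-refl i)
  ... | no  i≢j  = sym (δ-≢ (i≢j ∘ sym))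

  δ-suc : ∀ {n} (i j : Fin n) → δ (Fin.suc i) (Fin.suc j) ≡ δ i j
  δ-suc i j with i ≟ᶠ j
  ... | yes _ = refl
  ... | no  _ = refl

  ∑-δ : ∀ n (j : Fin n) (f : Fin n → ℤ) → ∑ n (λ i → δ i j * f i) ≡ f j
  ∑-δ (suc n) Fin.zero f = begin
    + 1 * f Fin.zero + ∑ n (λ i → + 0 * f (Fin.suc i))
      ≡⟨ cong₂ _+_ (*-identityˡ (f Fin.zero)) (trans (∑-cong n (λ i → *-zeroˡ (f (Fin.suc i)))) (∑-0 n)) ⟩
    f Fin.zero + + 0
      ≡⟨ +-identityʳ _ ⟩
    f Fin.zero ∎
    where open ≡-Reasoning
  ∑-δ (suc n) (Fin.suc j) f = begin
    + 0 * f Fin.zero + ∑ n (λ i → δ (Fin.suc i) (Fin.suc j) * f (Fin.suc i))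
      ≡⟨ cong₂ _+_ (*-zeroˡ (f Fin.zero)) (∑-cong n (λ i → cong (_* f (Fin.suc i)) (δ-suc i j))) ⟩
    + 0 + ∑ n (λ i → δ i j * f (Fin.suc i))
      ≡⟨ +-identityˡ _ ⟩
    ∑ n (λ i → δ i j * f (Fin.suc i))
      ≡⟨ ∑-δ n j (f ∘ Fin.suc) ⟩
    f (Fin.suc j) ∎
    where open ≡-Reasoning

  ∑-δ′ : ∀ n (j : Fin n) (f : Fin n → ℤ) → ∑ n (λ i → δ j i * f i) ≡ f j
  ∑-δ′ n j f = trans (∑-cong n (λ i → cong (_* f i) (δ-sym j i))) (∑-δ n j f)

  ind-refl : ∀ {d n} (u : Word d n) → ind u u ≡ + 1
  ind-refl u = 𝟙-yes (≡-dec _≟ᶠ_ u u) refl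

  ind-≢ : ∀ {d n} {u v : Word d n} → u ≢ v → ind u v ≡ + 0
  ind-≢ {u = u} {v} = 𝟙-no (≡-dec _≟ᶠ_ u v)

  ind-∷ : ∀ {d n} (x y : Fin d) (u v : Word d n) → ind (x ∷ u) (y ∷ v) ≡ δ x y * ind u v
  ind-∷ x y u v with x ≟ᶠ y | ≡-dec _≟ᶠ_ u v
  ... | yes refl | yes refl = refl
  ... | yes refl | no _     = refl
  ... | no _     | yes _    = refl
  ... | no _     | no _     = refl

  ind-sym : ∀ {d n} (u v : Word d n) → ind u v ≡ ind v u
  ind-sym []      []      = refl
  ind-sym (x ∷ u) (y ∷ v) = begin
    ind (x ∷ u) (y ∷ v)  ≡⟨ ind-∷ x y u v ⟩
    δ x y * ind u v      ≡⟨ cong₂ _*_ (δ-sym x y) (ind-sym u v) ⟩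
    δ y x * ind v u      ≡⟨ sym (ind-∷ y x v u) ⟩
    ind (y ∷ v) (x ∷ u)  ∎
    where open ≡-Reasoning

  ∑W : ∀ {d} n → (Word d n → ℤ) → ℤ
  ∑W zero        f = f []
  ∑W {d} (suc n) f = ∑ d (λ x → ∑W n (λ w → f (x ∷ w)))

  ∑W-cong : ∀ {d} n {f g : Word d n → ℤ} → (∀ w → f w ≡ g w) → ∑W n f ≡ ∑W n g
  ∑W-cong zero        f≗g = f≗g []
  ∑W-cong {d} (suc n) f≗g = ∑-cong d (λ x → ∑W-cong n (λ w → f≗g (x ∷ w)))

  ∑W-0 : ∀ {d} n → ∑W {d} n (λ _ → + 0) ≡ + 0
  ∑W-0 zero        = refl
  ∑W-0 {d} (suc n) = trans (∑-cong d (λ _ → ∑W-0 n)) (∑-0 d)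

  ∑W-+ : ∀ {d} n (f g : Word d n → ℤ) → ∑W n (λ w → f w + g w) ≡ ∑W n f + ∑W n g
  ∑W-+ zero        f g = refl
  ∑W-+ {d} (suc n) f g = trans (∑-cong d (λ x → ∑W-+ n _ _)) (∑-+ d _ _)

  ∑W-- : ∀ {d} n (f g : Word d n → ℤ) → ∑W n (λ w → f w - g w) ≡ ∑W n f - ∑W n g
  ∑W-- zero        f g = refl
  ∑W-- {d} (suc n) f g = trans (∑-cong d (λ x → ∑W-- n _ _)) (∑-- d _ _)

  ∑W-*ˡ : ∀ {d} n c (f : Word d n → ℤ) → c * ∑W n f ≡ ∑W n (λ w → c * f w)
  ∑W-*ˡ zero        c f = refl
  ∑W-*ˡ {d} (suc n) c f = trans (∑-*ˡ d c _) (∑-cong d (λ x → ∑W-*ˡ n c _))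

  ∑W-*ʳ : ∀ {d} n (f : Word d n → ℤ) c → ∑W n f * c ≡ ∑W n (λ w → f w * c)
  ∑W-*ʳ n f c = trans (*-comm (∑W n f) c) (trans (∑W-*ˡ n c f) (∑W-cong n (λ w → *-comm c (f w))))

  ∑W-∑ : ∀ {d} n k (f : Word d n → Fin k → ℤ) →
         ∑W n (λ w → ∑ k (f w)) ≡ ∑ k (λ i → ∑W n (λ w → f w i))
  ∑W-∑ zero        k f = refl
  ∑W-∑ {d} (suc n) k f = trans (∑-cong d (λ x → ∑W-∑ n k _)) (∑-swap d k _)

  ∑W-swap : ∀ {d} n k (f : Word d n → Word d k → ℤ) →
            ∑W n (λ w → ∑W k (f w)) ≡ ∑W k (λ v → ∑W n (λ w → f w v))
  ∑W-swap zero        k f = refl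
  ∑W-swap {d} (suc n) k f = trans (∑-cong d (λ x → ∑W-swap n k _)) (sym (∑W-∑ k d _))

  ∑W-++ : ∀ {d} a b (f : Word d (a ℕ.+ b) → ℤ) → ∑W (a ℕ.+ b) f ≡ ∑W a (λ u → ∑W b (λ v → f (u ++ v)))
  ∑W-++ zero        b f = refl
  ∑W-++ {d} (suc a) b f = ∑-cong d (λ x → ∑W-++ a b (λ w → f (x ∷ w)))

  ∑W-ind : ∀ {d} n (u : Word d n) (f : Word d n → ℤ) → ∑W n (λ w → ind w u * f w) ≡ f u
  ∑W-ind zero        []      f = *-identityˡ (f [])
  ∑W-ind {d} (suc n) (x ∷ u) f = begin
    ∑ d (λ y → ∑W n (λ w → ind (y ∷ w) (x ∷ u) * f (y ∷ w)))
      ≡⟨ ∑-cong d (λ y → ∑W-cong n (λ w → trans (cong (_* f (y ∷ w)) (ind-∷ y x w u)) (*-assoc (δ y x) _ _))) ⟩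
    ∑ d (λ y → ∑W n (λ w → δ y x * (ind w u * f (y ∷ w))))
      ≡⟨ ∑-cong d (λ y → sym (∑W-*ˡ n (δ y x) _)) ⟩
    ∑ d (λ y → δ y x * ∑W n (λ w → ind w u * f (y ∷ w)))
      ≡⟨ ∑-δ d x _ ⟩
    ∑W n (λ w → ind w u * f (x ∷ w))
      ≡⟨ ∑W-ind n u (λ w → f (x ∷ w)) ⟩
    f (x ∷ u) ∎
    where open ≡-Reasoning

  ∑W-ind′ : ∀ {d} n (u : Word d n) (f : Word d n → ℤ) → ∑W n (λ w → ind u w * f w) ≡ f u
  ∑W-ind′ n u f = trans (∑W-cong n (λ w → cong (_* f w) (ind-sym u w))) (∑W-ind n u f)

  ∑² : ∀ {d} → (Fin d → Fin d → ℤ) → ℤ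
  ∑² {d} f = ∑ d (λ s → ∑ d (f s))

  ∑²-cong : ∀ {d} {f g : Fin d → Fin d → ℤ} → (∀ s t → f s t ≡ g s t) → ∑² f ≡ ∑² g
  ∑²-cong {d} f≗g = ∑-cong d (λ s → ∑-cong d (f≗g s))

  ∑²-- : ∀ {d} (f g : Fin d → Fin d → ℤ) → ∑² (λ s t → f s t - g s t) ≡ ∑² f - ∑² g
  ∑²-- {d} f g = trans (∑-cong d (λ s → ∑-- d (f s) (g s))) (∑-- d _ _)

  ∑²-*ˡ : ∀ {d} c (f : Fin d → Fin d → ℤ) → c * ∑² f ≡ ∑² (λ s t → c * f s t)
  ∑²-*ˡ {d} c f = trans (∑-*ˡ d c _) (∑-cong d (λ s → ∑-*ˡ d c (f s)))

  ∑²-∑ : ∀ {d} k (f : Fin d → Fin d → Fin k → ℤ) →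
         ∑² (λ s t → ∑ k (f s t)) ≡ ∑ k (λ j → ∑² (λ s t → f s t j))
  ∑²-∑ {d} k f = trans (∑-cong d (λ s → ∑-swap d k (f s))) (∑-swap d k (λ s j → ∑ d (λ t → f s t j)))

  ∑²-∑W : ∀ {d} n (f : Fin d → Fin d → Word d n → ℤ) →
          ∑² (λ s t → ∑W n (f s t)) ≡ ∑W n (λ w → ∑² (λ s t → f s t w))
  ∑²-∑W {d} n f = trans (∑-cong d (λ s → sym (∑W-∑ n d (λ w t → f s t w))))
                        (sym (∑W-∑ n d (λ w s → ∑ d (λ t → f s t w))))

  ∑²-δ : ∀ {d} (f : Fin d → Fin d → ℤ) a b → ∑² (λ s t → (δ s a * δ t b) * f s t) ≡ f a b
  ∑²-δ {d} f a b = begin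
    ∑² (λ s t → (δ s a * δ t b) * f s t)
      ≡⟨ ∑-cong d (λ s → trans (∑-cong d (λ t → *-assoc (δ s a) (δ t b) (f s t))) (sym (∑-*ˡ d (δ s a) _))) ⟩
    ∑ d (λ s → δ s a * ∑ d (λ t → δ t b * f s t))
      ≡⟨ ∑-δ d a _ ⟩
    ∑ d (λ t → δ t b * f a t)
      ≡⟨ ∑-δ d b (f a) ⟩
    f a b ∎
    where open ≡-Reasoning

open Sums

module Congruence (p : ℕ) where

  -- A record rather than a synonym for (+ p) ∣ (x - y), so that x and y
  -- can be inferred from a proof of x ≈ y.
  infix 4 _≈_
  record _≈_ (x y : ℤ) : Set where
    constructor mk≈
    field un≈ : + p Signed.∣ x - y
  open _≈_ public

  ≈-via : ∀ {x y z} → x - y ≡ z → + p Signed.∣ z → x ≈ y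
  ≈-via refl p∣z = mk≈ p∣z

  ≈-reflexive : ∀ {x y} → x ≡ y → x ≈ y
  ≈-reflexive {x} refl = ≈-via (+-inverseʳ x) (Signed.divides (+ 0) refl)

  ≈-refl : ∀ {x} → x ≈ x
  ≈-refl = ≈-reflexive refl

  ≈-sym : ∀ {x y} → x ≈ y → y ≈ x
  ≈-sym {x} {y} x≈y = ≈-via (lemma x y) (Signed.∣m⇒∣-m (un≈ x≈y))
    where lemma : ∀ x y → y - x ≡ - (x - y)
          lemma = solve-∀

  ≈-trans : ∀ {x y z} → x ≈ y → y ≈ z → x ≈ z
  ≈-trans {x} {y} {z} x≈y y≈z = ≈-via (sym (+-minus-telescope x y z)) (Signed.∣m∣n⇒∣m+n (un≈ x≈y) (un≈ y≈z))

  +-cong≈ : ∀ {x y u v} → x ≈ y → u ≈ v → x + u ≈ y + v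
  +-cong≈ {x} {y} {u} {v} x≈y u≈v = ≈-via (lemma x y u v) (Signed.∣m∣n⇒∣m+n (un≈ x≈y) (un≈ u≈v))
    where lemma : ∀ x y u v → (x + u) - (y + v) ≡ (x - y) + (u - v)
          lemma = solve-∀

  neg-cong≈ : ∀ {x y} → x ≈ y → - x ≈ - y
  neg-cong≈ {x} {y} x≈y = ≈-via (lemma x y) (Signed.∣m⇒∣-m (un≈ x≈y))
    where lemma : ∀ x y → - x - - y ≡ - (x - y)
          lemma = solve-∀

  -‿cong≈ : ∀ {x y u v} → x ≈ y → u ≈ v → x - u ≈ y - v
  -‿cong≈ x≈y u≈v = +-cong≈ x≈y (neg-cong≈ u≈v)

  *-cong≈ : ∀ {x y u v} → x ≈ y → u ≈ v → x * u ≈ y * v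
  *-cong≈ {x} {y} {u} {v} x≈y u≈v =
    ≈-via (lemma x y u v) (Signed.∣m∣n⇒∣m+n (Signed.∣n⇒∣m*n x (un≈ u≈v)) (Signed.∣m⇒∣m*n v (un≈ x≈y)))
    where lemma : ∀ x y u v → x * u - y * v ≡ x * (u - v) + (x - y) * v
          lemma = solve-∀

  *-congˡ≈ : ∀ x {u v} → u ≈ v → x * u ≈ x * v
  *-congˡ≈ x = *-cong≈ (≈-refl {x})

  *-congʳ≈ : ∀ u {x y} → x ≈ y → x * u ≈ y * u
  *-congʳ≈ u x≈y = *-cong≈ x≈y (≈-refl {u})

  *-≈0ˡ : ∀ {x} y → x ≈ + 0 → x * y ≈ + 0
  *-≈0ˡ y x≈0 = ≈-trans (*-congʳ≈ y x≈0) (≈-reflexive (*-zeroˡ y))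

  *-≈0ʳ : ∀ x {y} → y ≈ + 0 → x * y ≈ + 0
  *-≈0ʳ x y≈0 = ≈-trans (*-congˡ≈ x y≈0) (≈-reflexive (*-zeroʳ x))

  ≈-setoid : Setoid _ _
  ≈-setoid = record
    { Carrier = ℤ ; _≈_ = _≈_
    ; isEquivalence = record { refl = ≈-refl ; sym = ≈-sym ; trans = ≈-trans } }

  module ≈-Reasoning = Relation.Binary.Reasoning.Setoid ≈-setoid

  toMod : ∀ {x y} → x ≈ y → x ≡[mod p ] y
  toMod x≈y = Signed.∣⇒∣ᵤ (un≈ x≈y)

  fromMod : ∀ {x y} → x ≡[mod p ] y → x ≈ y
  fromMod x≡y = mk≈ (Signed.∣ᵤ⇒∣ x≡y)

  ∑-cong≈ : ∀ n {f g : Fin n → ℤ} → (∀ i → f i ≈ g i) → ∑ n f ≈ ∑ n g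
  ∑-cong≈ zero    f≈g = ≈-refl
  ∑-cong≈ (suc n) f≈g = +-cong≈ (f≈g Fin.zero) (∑-cong≈ n (f≈g ∘ Fin.suc))

  ∑-≈0 : ∀ n {f : Fin n → ℤ} → (∀ i → f i ≈ + 0) → ∑ n f ≈ + 0
  ∑-≈0 n f≈0 = ≈-trans (∑-cong≈ n f≈0) (≈-reflexive (∑-0 n))

  ∑W-cong≈ : ∀ {d} n {f g : Word d n → ℤ} → (∀ w → f w ≈ g w) → ∑W n f ≈ ∑W n g
  ∑W-cong≈ zero        f≈g = f≈g []
  ∑W-cong≈ {d} (suc n) f≈g = ∑-cong≈ d (λ x → ∑W-cong≈ n (λ w → f≈g (x ∷ w)))

  ∑W-≈0 : ∀ {d} n {f : Word d n → ℤ} → (∀ w → f w ≈ + 0) → ∑W n f ≈ + 0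
  ∑W-≈0 n f≈0 = ≈-trans (∑W-cong≈ n f≈0) (≈-reflexive (∑W-0 n))

  ∑²-cong≈ : ∀ {d} {f g : Fin d → Fin d → ℤ} → (∀ s t → f s t ≈ g s t) → ∑² f ≈ ∑² g
  ∑²-cong≈ {d} f≈g = ∑-cong≈ d (λ s → ∑-cong≈ d (f≈g s))

  ∑²-≈0 : ∀ {d} {f : Fin d → Fin d → ℤ} → (∀ s t → f s t ≈ + 0) → ∑² f ≈ + 0
  ∑²-≈0 {d} f≈0 = ∑-≈0 d (λ s → ∑-≈0 d (f≈0 s))

  multiple-≈0 : ∀ k → k * + p ≈ + 0
  multiple-≈0 k = mk≈ (Signed.divides k (+-identityʳ (k * + p)))

module InverseModPrime (p : ℕ) (p-prime : Prime p) where
  open Congruence p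

  ≈0? : ∀ x → Dec (x ≈ + 0)
  ≈0? x with + p Signed.∣? (x - + 0)
  ... | yes p∣x = yes (mk≈ p∣x)
  ... | no  p∤x = no (p∤x ∘ un≈)

  1≉0 : ¬ (+ 1 ≈ + 0)
  1≉0 1≈0 with ℕDiv.∣1⇒≡1 (toMod 1≈0)
  ... | refl with prime⇒nonTrivial p-prime
  ...   | ()

  private
    inverse-coprime : ∀ n → Coprime n p → Σ ℤ λ u → u * + n ≈ + 1
    inverse-coprime n coprime with coprime-Bézout coprime
    ... | Bézout.+- a b 1+bp≡an = + a , (begin
      + a * + n          ≡⟨ sym (pos-* a n) ⟩
      + (a ℕ.* n)        ≡⟨ cong +_ (sym 1+bp≡an) ⟩
      + (1 ℕ.+ b ℕ.* p)  ≡⟨ trans (pos-+ 1 (b ℕ.* p)) (cong (_+_ (+ 1)) (pos-* b p)) ⟩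
      + 1 + + b * + p    ≈⟨ +-cong≈ (≈-refl {+ 1}) (multiple-≈0 (+ b)) ⟩
      + 1 + + 0          ≡⟨ +-identityʳ (+ 1) ⟩
      + 1                ∎)
      where open ≈-Reasoning
    ... | Bézout.-+ a b 1+an≡bp = - + a , (begin
      - + a * + n              ≡⟨ sym (neg-distribˡ-* (+ a) (+ n)) ⟩
      - (+ a * + n)            ≡⟨ sym (lemma (+ a * + n)) ⟩
      + 1 - (+ 1 + + a * + n)  ≡⟨ cong (λ x → + 1 - (+ 1 + x)) (sym (pos-* a n)) ⟩
      + 1 - (+ 1 + + (a ℕ.* n)) ≡⟨ cong (λ x → + 1 - x) (sym (pos-+ 1 (a ℕ.* n))) ⟩
      + 1 - + (1 ℕ.+ a ℕ.* n)  ≡⟨ cong (λ x → + 1 - + x) 1+an≡bp ⟩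
      + 1 - + (b ℕ.* p)        ≡⟨ cong (λ x → + 1 - x) (pos-* b p) ⟩
      + 1 - + b * + p          ≈⟨ -‿cong≈ (≈-refl {+ 1}) (multiple-≈0 (+ b)) ⟩
      + 1 - + 0                ≡⟨ +-identityʳ (+ 1) ⟩
      + 1                      ∎)
      where
      open ≈-Reasoning
      lemma : ∀ x → + 1 - (+ 1 + x) ≡ - x
      lemma = solve-∀

    coprime-≉0 : ∀ x → ¬ (x ≈ + 0) → Coprime ∣ x ∣ p
    coprime-≉0 x x≉0 {c} (c∣x , c∣p) with prime⇒irreducible p-prime c∣p
    ... | inj₁ c≡1 = c≡1
    ... | inj₂ refl = ⊥-elim (x≉0 (mk≈ (subst (+ p Signed.∣_) (sym (+-identityʳ x)) (Signed.∣ᵤ⇒∣ c∣x))))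

  inverse : ∀ x → ¬ (x ≈ + 0) → Σ ℤ λ u → u * x ≈ + 1
  inverse (+ n)     x≉0 = inverse-coprime n (coprime-≉0 (+ n) x≉0)
  inverse -[1+ n ] x≉0 with inverse-coprime (suc n) (coprime-≉0 -[1+ n ] x≉0)
  ... | u , u*x≈1 = - u , ≈-trans (≈-reflexive (lemma u (+ suc n))) u*x≈1
    where lemma : ∀ u x → - u * - x ≡ u * x
          lemma = solve-∀

module Echelon (p : ℕ) {d : ℕ} (inA : Fin d → Bool) where
  open Congruence p

  -- The coefficients c x y of a homogeneous quadratic element Σ c x y ξ_x ξ_y.
  Quadratic : Set
  Quadratic = Fin d → Fin d → ℤ

  record _∈Span_ {k} (q : Quadratic) (ρ : Fin k → Quadratic) : Set where
    constructor span
    field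
      coefficients : Fin k → ℤ
      combination  : ∀ x y → q x y ≈ ∑ k (λ i → coefficients i * ρ i x y)
  open _∈Span_ public

  LinearlyIndependentOnA×B : ∀ {k} → (Fin k → Quadratic) → Set
  LinearlyIndependentOnA×B {k} ρ =
    ∀ (c : Fin k → ℤ) →
      (∀ a b → inA a ≡ true → inA b ≡ false → ∑ k (λ i → c i * ρ i a b) ≈ + 0) →
      ∀ i → c i ≈ + 0

  record EchelonBasis {k} (ρ : Fin k → Quadratic) : Set where
    field
      pivotA pivotB  : Fin k → Fin d
      pivotA∈A       : ∀ j → inA (pivotA j) ≡ true
      pivotB∈B       : ∀ j → inA (pivotB j) ≡ false
      basis          : Fin k → Quadratic
      basis∈span     : ∀ j → basis j ∈Span ρ
      basis-at-pivot : ∀ j l → basis j (pivotA l) (pivotB l) ≈ δ j l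
      expansion      : ∀ i x y → ρ i x y ≈ ∑ k (λ j → ρ i (pivotA j) (pivotB j) * basis j x y)

  module _ {k} {ρ : Fin k → Quadratic} where

    ∈Span-cong : ∀ {q q′} → (∀ x y → q x y ≈ q′ x y) → q′ ∈Span ρ → q ∈Span ρ
    ∈Span-cong q≈q′ (span t q′≈) = span t λ x y → ≈-trans (q≈q′ x y) (q′≈ x y)

    ∈Span-lin : ∀ a b {q r} → q ∈Span ρ → r ∈Span ρ → (λ x y → a * q x y + b * r x y) ∈Span ρ
    ∈Span-lin a b (span t q≈) (span s r≈) = span (λ i → a * t i + b * s i) λ x y → begin
      a * _ + b * _
        ≈⟨ +-cong≈ (*-congˡ≈ a (q≈ x y)) (*-congˡ≈ b (r≈ x y)) ⟩
      a * ∑ k (λ i → t i * ρ i x y) + b * ∑ k (λ i → s i * ρ i x y)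
        ≡⟨ cong₂ _+_ (∑-*ˡ k a _) (∑-*ˡ k b _) ⟩
      ∑ k (λ i → a * (t i * ρ i x y)) + ∑ k (λ i → b * (s i * ρ i x y))
        ≡⟨ sym (∑-+ k _ _) ⟩
      ∑ k (λ i → a * (t i * ρ i x y) + b * (s i * ρ i x y))
        ≡⟨ ∑-cong k (λ i → lemma a b (t i) (s i) (ρ i x y)) ⟩
      ∑ k (λ i → (a * t i + b * s i) * ρ i x y) ∎
      where
      open ≈-Reasoning
      lemma : ∀ a b t s r → a * (t * r) + b * (s * r) ≡ (a * t + b * s) * r
      lemma = solve-∀

    ∈Span-0 : (λ _ _ → + 0) ∈Span ρ
    ∈Span-0 = span (λ _ → + 0) λ x y → ≈-reflexive (sym (trans (∑-cong k (λ i → *-zeroˡ (ρ i x y))) (∑-0 k)))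

    ∈Span-∑ : ∀ n (c : Fin n → ℤ) {q : Fin n → Quadratic} →
              (∀ j → q j ∈Span ρ) → (λ x y → ∑ n (λ j → c j * q j x y)) ∈Span ρ
    ∈Span-∑ zero    c q∈ = ∈Span-0
    ∈Span-∑ (suc n) c q∈ =
      ∈Span-cong (λ x y → ≈-reflexive (cong (_+_ (c Fin.zero * _)) (sym (*-identityˡ _))))
        (∈Span-lin (c Fin.zero) (+ 1) (q∈ Fin.zero) (∈Span-∑ n (c ∘ Fin.suc) (q∈ ∘ Fin.suc)))

  ∈Span-tail : ∀ {k} {ρ : Fin (suc k) → Quadratic} {q} → q ∈Span (ρ ∘ Fin.suc) → q ∈Span ρ
  ∈Span-tail {k} {ρ} (span t q≈) = span (+ 0 ∷ᶠ t) λ x y →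
    ≈-trans (q≈ x y) (≈-reflexive (sym (trans (cong (_+ ∑ k (λ i → t i * ρ (Fin.suc i) x y)) (*-zeroˡ (ρ Fin.zero x y)))
                                              (+-identityˡ _))))

  ∈Span-head : ∀ {k} (ρ : Fin (suc k) → Quadratic) → ρ Fin.zero ∈Span ρ
  ∈Span-head {k} ρ = span (λ i → δ i Fin.zero) λ x y → ≈-reflexive (sym (∑-δ (suc k) Fin.zero (λ i → ρ i x y)))

  independent-tail : ∀ {k} {ρ : Fin (suc k) → Quadratic} →
                     LinearlyIndependentOnA×B ρ → LinearlyIndependentOnA×B (ρ ∘ Fin.suc)
  independent-tail {k} {ρ} indep c c·ρ≈0 i = indep (+ 0 ∷ᶠ c) 0c·ρ≈0 (Fin.suc i)
    where
    0c·ρ≈0 : ∀ a b → inA a ≡ true → inA b ≡ false → ∑ (suc k) (λ i → (+ 0 ∷ᶠ c) i * ρ i a b) ≈ + 0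
    0c·ρ≈0 a b a∈A b∈B = ≈-trans
      (≈-reflexive (trans (cong (_+ ∑ k (λ i → c i * ρ (Fin.suc i) a b)) (*-zeroˡ (ρ Fin.zero a b))) (+-identityˡ _)))
      (c·ρ≈0 a b a∈A b∈B)

module GaussianElimination (p : ℕ) (p-prime : Prime p) {d : ℕ} (inA : Fin d → Bool) where
  open Congruence p
  open InverseModPrime p p-prime
  open Echelon p inA

  module Extension {k} (ρ : Fin (suc k) → Quadratic) (indep : LinearlyIndependentOnA×B ρ)
                   (E : EchelonBasis (ρ ∘ Fin.suc)) where
    open EchelonBasis E

    r : Quadratic
    r = ρ Fin.zero

    project : Quadratic → Quadratic
    project q x y = ∑ k (λ j → q (pivotA j) (pivotB j) * basis j x y)

    residual : Quadratic
    residual x y = r x y - project r x y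

    residual-at-pivot : ∀ l → residual (pivotA l) (pivotB l) ≈ + 0
    residual-at-pivot l = begin
      r (pivotA l) (pivotB l) - project r (pivotA l) (pivotB l)
        ≈⟨ -‿cong≈ (≈-refl {r (pivotA l) (pivotB l)})
                   (∑-cong≈ k (λ j → *-congˡ≈ (r (pivotA j) (pivotB j)) (basis-at-pivot j l))) ⟩
      r (pivotA l) (pivotB l) - ∑ k (λ j → r (pivotA j) (pivotB j) * δ j l)
        ≡⟨ cong (_-_ (r (pivotA l) (pivotB l))) (trans (∑-cong k (λ j → *-comm (r (pivotA j) (pivotB j)) (δ j l)))
                                                       (∑-δ k l (λ j → r (pivotA j) (pivotB j)))) ⟩
      r (pivotA l) (pivotB l) - r (pivotA l) (pivotB l)
        ≡⟨ +-inverseʳ (r (pivotA l) (pivotB l)) ⟩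
      + 0 ∎
      where open ≈-Reasoning

    residual-coefficients : Fin (suc k) → ℤ
    residual-coefficients = + 1 ∷ᶠ λ i → - ∑ k (λ j → r (pivotA j) (pivotB j) * coefficients (basis∈span j) i)

    residual-combination : ∀ x y → ∑ (suc k) (λ i → residual-coefficients i * ρ i x y) ≈ residual x y
    residual-combination x y = +-cong≈ (≈-reflexive (*-identityˡ (r x y))) (≈-sym (begin
      - project r x y
        ≈⟨ neg-cong≈ (∑-cong≈ k (λ j → *-congˡ≈ (c j) (combination (basis∈span j) x y))) ⟩
      - ∑ k (λ j → c j * ∑ k (λ i → t j i * ρ′ i))
        ≡⟨ cong -_ (∑-cong k (λ j → trans (∑-*ˡ k (c j) _) (∑-cong k (λ i → sym (*-assoc (c j) (t j i) (ρ′ i)))))) ⟩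
      - ∑ k (λ j → ∑ k (λ i → c j * t j i * ρ′ i))
        ≡⟨ cong -_ (∑-swap k k _) ⟩
      - ∑ k (λ i → ∑ k (λ j → c j * t j i * ρ′ i))
        ≡⟨ cong -_ (∑-cong k (λ i → sym (∑-*ʳ k (λ j → c j * t j i) (ρ′ i)))) ⟩
      - ∑ k (λ i → ∑ k (λ j → c j * t j i) * ρ′ i)
        ≡⟨ sym (∑-neg k _) ⟩
      ∑ k (λ i → - (∑ k (λ j → c j * t j i) * ρ′ i))
        ≡⟨ ∑-cong k (λ i → neg-distribˡ-* (∑ k (λ j → c j * t j i)) (ρ′ i)) ⟩
      ∑ k (λ i → - ∑ k (λ j → c j * t j i) * ρ′ i) ∎))
      where
      open ≈-Reasoning
      c : Fin k → ℤ
      c j = r (pivotA j) (pivotB j)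
      t : Fin k → Fin k → ℤ
      t j = coefficients (basis∈span j)
      ρ′ : Fin k → ℤ
      ρ′ i = ρ (Fin.suc i) x y

    -- Independence forbids residual from vanishing on A × B, and the
    -- search for a non-vanishing entry is finite.
    residual-≉0 : Σ (Fin d) λ a → Σ (Fin d) λ b → inA a ≡ true × inA b ≡ false × ¬ residual a b ≈ + 0
    residual-≉0 with FinP.any? (λ a → FinP.any? (λ b →
                       inA a Boolₚ.≟ true ×-dec inA b Boolₚ.≟ false ×-dec ¬? (≈0? (residual a b))))
    ... | yes (a , b , found) = a , b , found
    ... | no none = ⊥-elim (1≉0 (indep residual-coefficients combination≈0 Fin.zero))
      where
      vanishes : ∀ a b → inA a ≡ true → inA b ≡ false → residual a b ≈ + 0
      vanishes a b a∈A b∈B with ≈0? (residual a b)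
      ... | yes ≈0 = ≈0
      ... | no  ≉0 = ⊥-elim (none (a , b , a∈A , b∈B , ≉0))
      combination≈0 : ∀ a b → inA a ≡ true → inA b ≡ false →
                      ∑ (suc k) (λ i → residual-coefficients i * ρ i a b) ≈ + 0
      combination≈0 a b a∈A b∈B = ≈-trans (residual-combination a b) (vanishes a b a∈A b∈B)

    module _ {a b : Fin d} (a∈A : inA a ≡ true) (b∈B : inA b ≡ false) (≉0 : ¬ residual a b ≈ + 0) where

      u : ℤ
      u = proj₁ (inverse (residual a b) ≉0)

      u*residual≈1 : u * residual a b ≈ + 1
      u*residual≈1 = proj₂ (inverse (residual a b) ≉0)

      normalised : Quadratic
      normalised x y = u * residual x y

      normalised-at-pivot : ∀ l → normalised (pivotA l) (pivotB l) ≈ + 0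
      normalised-at-pivot l = *-≈0ʳ u (residual-at-pivot l)

      basis′ : Fin (suc k) → Quadratic
      basis′ Fin.zero    = normalised
      basis′ (Fin.suc j) x y = basis j x y - basis j a b * normalised x y

      normalised∈span : normalised ∈Span ρ
      normalised∈span = ∈Span-cong (λ x y → ≈-reflexive (lemma u (r x y) (project r x y)))
        (∈Span-lin u (- u) (∈Span-head ρ)
          (∈Span-∑ k (λ j → r (pivotA j) (pivotB j)) (λ j → ∈Span-tail (basis∈span j))))
        where lemma : ∀ u r s → u * (r - s) ≡ u * r + - u * s
              lemma = solve-∀

      basis′∈span : ∀ j → basis′ j ∈Span ρ
      basis′∈span Fin.zero    = normalised∈span
      basis′∈span (Fin.suc j) =
        ∈Span-cong (λ x y → ≈-reflexive (lemma (basis j x y) (basis j a b) (normalised x y)))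
          (∈Span-lin (+ 1) (- basis j a b) (∈Span-tail (basis∈span j)) normalised∈span)
        where lemma : ∀ r c n → r - c * n ≡ + 1 * r + - c * n
              lemma = solve-∀

      basis′-at-pivot : ∀ j l → basis′ j ((a ∷ᶠ pivotA) l) ((b ∷ᶠ pivotB) l) ≈ δ j l
      basis′-at-pivot Fin.zero    Fin.zero    = u*residual≈1
      basis′-at-pivot Fin.zero    (Fin.suc l) = normalised-at-pivot l
      basis′-at-pivot (Fin.suc j) Fin.zero    = begin
        basis j a b - basis j a b * normalised a b  ≈⟨ -‿cong≈ (≈-refl {basis j a b}) (*-congˡ≈ (basis j a b) u*residual≈1) ⟩
        basis j a b - basis j a b * + 1             ≡⟨ cong (_-_ (basis j a b)) (*-identityʳ (basis j a b)) ⟩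
        basis j a b - basis j a b                   ≡⟨ +-inverseʳ (basis j a b) ⟩
        + 0                                         ∎
        where open ≈-Reasoning
      basis′-at-pivot (Fin.suc j) (Fin.suc l) = begin
        basis j (pivotA l) (pivotB l) - basis j a b * normalised (pivotA l) (pivotB l)
          ≈⟨ -‿cong≈ (basis-at-pivot j l) (*-≈0ʳ (basis j a b) (normalised-at-pivot l)) ⟩
        δ j l - + 0
          ≡⟨ trans (+-identityʳ (δ j l)) (sym (δ-suc j l)) ⟩
        δ (Fin.suc j) (Fin.suc l) ∎
        where open ≈-Reasoning

      expansion-via-basis′ : ∀ (q : Quadratic) x y →
        ∑ (suc k) (λ j → q ((a ∷ᶠ pivotA) j) ((b ∷ᶠ pivotB) j) * basis′ j x y)
          ≡ project q x y + (q a b - project q a b) * normalised x y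
      expansion-via-basis′ q x y = begin
        q a b * normalised x y + ∑ k (λ j → q (pivotA j) (pivotB j) * (basis j x y - basis j a b * normalised x y))
          ≡⟨ cong (_+_ (q a b * normalised x y)) (begin
               ∑ k (λ j → q (pivotA j) (pivotB j) * (basis j x y - basis j a b * normalised x y))
                 ≡⟨ ∑-cong k (λ j → distrib (q (pivotA j) (pivotB j)) (basis j x y) (basis j a b) (normalised x y)) ⟩
               ∑ k (λ j → q (pivotA j) (pivotB j) * basis j x y - q (pivotA j) (pivotB j) * basis j a b * normalised x y)
                 ≡⟨ ∑-- k _ _ ⟩
               project q x y - ∑ k (λ j → q (pivotA j) (pivotB j) * basis j a b * normalised x y)
                 ≡⟨ cong (_-_ (project q x y)) (sym (∑-*ʳ k (λ j → q (pivotA j) (pivotB j) * basis j a b) (normalised x y))) ⟩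
               project q x y - project q a b * normalised x y ∎) ⟩
        q a b * normalised x y + (project q x y - project q a b * normalised x y)
          ≡⟨ regroup (q a b) (normalised x y) (project q x y) (project q a b) ⟩
        project q x y + (q a b - project q a b) * normalised x y ∎
        where
        open ≡-Reasoning
        distrib : ∀ q r c n → q * (r - c * n) ≡ q * r - q * c * n
        distrib = solve-∀
        regroup : ∀ qa n px pa → qa * n + (px - pa * n) ≡ px + (qa - pa) * n
        regroup = solve-∀

      expansion′ : ∀ i x y → ρ i x y ≈ ∑ (suc k) (λ j → ρ i ((a ∷ᶠ pivotA) j) ((b ∷ᶠ pivotB) j) * basis′ j x y)
      expansion′ Fin.zero x y = ≈-sym (begin
        _ ≡⟨ expansion-via-basis′ r x y ⟩
        project r x y + residual a b * (u * residual x y)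
          ≡⟨ cong (_+_ (project r x y)) (lemma (residual a b) u (residual x y)) ⟩
        project r x y + u * residual a b * residual x y
          ≈⟨ +-cong≈ (≈-refl {project r x y}) (*-congʳ≈ (residual x y) u*residual≈1) ⟩
        project r x y + + 1 * residual x y
          ≡⟨ lemma′ (r x y) (project r x y) ⟩
        r x y ∎)
        where
        open ≈-Reasoning
        lemma : ∀ v u w → v * (u * w) ≡ u * v * w
        lemma = solve-∀
        lemma′ : ∀ r s → s + + 1 * (r - s) ≡ r
        lemma′ = solve-∀
      expansion′ (Fin.suc i) x y = ≈-sym (begin
        _ ≡⟨ expansion-via-basis′ (ρ (Fin.suc i)) x y ⟩
        project ρ′ x y + (ρ′ a b - project ρ′ a b) * normalised x y
          ≈⟨ +-cong≈ (≈-sym (expansion i x y)) (*-≈0ˡ (normalised x y) ρ′-project≈0) ⟩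
        ρ′ x y + + 0
          ≡⟨ +-identityʳ (ρ′ x y) ⟩
        ρ′ x y ∎)
        where
        open ≈-Reasoning
        ρ′ = ρ (Fin.suc i)
        ρ′-project≈0 : ρ′ a b - project ρ′ a b ≈ + 0
        ρ′-project≈0 = ≈-trans (-‿cong≈ (expansion i a b) (≈-refl {project ρ′ a b}))
                               (≈-reflexive (+-inverseʳ (project ρ′ a b)))

      extended : EchelonBasis ρ
      extended = record
        { pivotA = a ∷ᶠ pivotA ; pivotB = b ∷ᶠ pivotB
        ; pivotA∈A = λ { Fin.zero → a∈A ; (Fin.suc j) → pivotA∈A j }
        ; pivotB∈B = λ { Fin.zero → b∈B ; (Fin.suc j) → pivotB∈B j }
        ; basis = basis′ ; basis∈span = basis′∈span
        ; basis-at-pivot = basis′-at-pivot ; expansion = expansion′ }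

    extension : EchelonBasis ρ
    extension with residual-≉0
    ... | a , b , a∈A , b∈B , ≉0 = extended a∈A b∈B ≉0

  echelonBasis : ∀ {k} (ρ : Fin k → Quadratic) → LinearlyIndependentOnA×B ρ → EchelonBasis ρ
  echelonBasis {zero}  ρ indep = record
    { pivotA = λ () ; pivotB = λ () ; pivotA∈A = λ () ; pivotB∈B = λ ()
    ; basis = λ () ; basis∈span = λ () ; basis-at-pivot = λ () ; expansion = λ () }
  echelonBasis {suc k} ρ indep =
    Extension.extension ρ indep (echelonBasis (ρ ∘ Fin.suc) (independent-tail {ρ = ρ} indep))

module IdealClosure (p : ℕ) {d m : ℕ} (cf : Coeffs d m) where
  open Congruence p

  ρ : Fin m → Fin d → Fin d → ℤ
  ρ = ρcoef cf

  ξ_·_ : ∀ {n} → Fin d → Hom d n → Hom d (suc n)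
  (ξ s · f) z = δ s (head z) * f (tail z)

  ρ-term : ∀ {b} → Fin m → Word d b → Term d m (2 ℕ.+ b)
  ρ-term {b} k v = term 0 b refl [] v k (+ 1)

  ρ-term-value : ∀ {b} k (v : Word d b) z₀ z₁ z → evalTerm cf (ρ-term k v) (z₀ ∷ z₁ ∷ z) ≡ ρ k z₀ z₁ * ind v z
  ρ-term-value k v z₀ z₁ z = trans (*-identityˡ _) (*-identityˡ (ρ k z₀ z₁ * ind v z))

  private
    scaleTerm : ∀ {n} → ℤ → Term d m n → Term d m n
    scaleTerm c (term a b deg u v k c′) = term a b deg u v k (c * c′)

    prefixTerm : ∀ {n} → Fin d → Term d m n → Term d m (suc n)
    prefixTerm s (term a b deg u v k c) = term (suc a) b (cong suc deg) (s ∷ u) v k c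

    evalTerms-++ : ∀ {n} (ts us : List (Term d m n)) w →
                   evalTerms cf (ts ++ᴸ us) w ≡ evalTerms cf ts w + evalTerms cf us w
    evalTerms-++ []       us w = sym (+-identityˡ _)
    evalTerms-++ (t ∷ ts) us w =
      trans (cong (_+_ (evalTerm cf t w)) (evalTerms-++ ts us w))
            (sym (+-assoc (evalTerm cf t w) (evalTerms cf ts w) (evalTerms cf us w)))

    evalTerms-scale : ∀ {n} c (ts : List (Term d m n)) w →
                      evalTerms cf (List.map (scaleTerm c) ts) w ≡ c * evalTerms cf ts w
    evalTerms-scale c []                          w = sym (*-zeroʳ c)
    evalTerms-scale c (term a b deg u v k c′ ∷ ts) w =
      trans (cong₂ _+_ (*-assoc c c′ _) (evalTerms-scale c ts w)) (sym (*-distribˡ-+ c _ _))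

    evalTerm-prefix : ∀ {n} s (t : Term d m n) x z → evalTerm cf (prefixTerm s t) (x ∷ z) ≡ δ s x * evalTerm cf t z
    evalTerm-prefix s (term a b refl u v k c) x z =
      trans (cong (λ e → c * (e * _)) (ind-∷ s x u (take a z))) (lemma c (δ s x) _ _)
      where lemma : ∀ c e i r → c * ((e * i) * r) ≡ e * (c * (i * r))
            lemma = solve-∀

    evalTerms-prefix : ∀ {n} s (ts : List (Term d m n)) x z →
                       evalTerms cf (List.map (prefixTerm s) ts) (x ∷ z) ≡ δ s x * evalTerms cf ts z
    evalTerms-prefix s []       x z = sym (*-zeroʳ (δ s x))
    evalTerms-prefix s (t ∷ ts) x z =
      trans (cong₂ _+_ (evalTerm-prefix s t x z) (evalTerms-prefix s ts x z)) (sym (*-distribˡ-+ (δ s x) _ _))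

  InIdeal-≈0 : ∀ {n} (f : Hom d n) → (∀ w → f w ≈ + 0) → InIdeal p cf f
  InIdeal-≈0 f f≈0 = [] , toMod ∘ f≈0

  InIdeal-cong : ∀ {n} (f g : Hom d n) → (∀ w → f w ≈ g w) → InIdeal p cf f → InIdeal p cf g
  InIdeal-cong f g f≈g (ts , f≈ts) = ts , λ w → toMod (≈-trans (≈-sym (f≈g w)) (fromMod {f w} (f≈ts w)))

  InIdeal-+ : ∀ {n} (f g : Hom d n) → InIdeal p cf f → InIdeal p cf g → InIdeal p cf (λ w → f w + g w)
  InIdeal-+ f g (ts , f≈ts) (us , g≈us) = ts ++ᴸ us , λ w →
    toMod (≈-trans (+-cong≈ (fromMod {f w} (f≈ts w)) (fromMod {g w} (g≈us w)))
                   (≈-reflexive (sym (evalTerms-++ ts us w))))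

  InIdeal-* : ∀ {n} c (f : Hom d n) → InIdeal p cf f → InIdeal p cf (λ w → c * f w)
  InIdeal-* c f (ts , f≈ts) = List.map (scaleTerm c) ts , λ w →
    toMod (≈-trans (*-congˡ≈ c (fromMod {f w} (f≈ts w))) (≈-reflexive (sym (evalTerms-scale c ts w))))

  InIdeal-- : ∀ {n} (f g : Hom d n) → InIdeal p cf f → InIdeal p cf g → InIdeal p cf (λ w → f w - g w)
  InIdeal-- f g f∈ g∈ = InIdeal-+ f (λ w → - g w) f∈
    (InIdeal-cong _ _ (λ w → ≈-reflexive (-1*i≡-i (g w))) (InIdeal-* (- + 1) g g∈))

  InIdeal-∑ : ∀ {n} k (f : Fin k → Hom d n) → (∀ i → InIdeal p cf (f i)) → InIdeal p cf (λ w → ∑ k (λ i → f i w))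
  InIdeal-∑ zero    f f∈ = InIdeal-≈0 _ (λ _ → ≈-refl)
  InIdeal-∑ (suc k) f f∈ = InIdeal-+ (f Fin.zero) _ (f∈ Fin.zero) (InIdeal-∑ k (f ∘ Fin.suc) (f∈ ∘ Fin.suc))

  InIdeal-∑W : ∀ {n} k (f : Word d k → Hom d n) → (∀ v → InIdeal p cf (f v)) → InIdeal p cf (λ w → ∑W k (λ v → f v w))
  InIdeal-∑W zero    f f∈ = f∈ []
  InIdeal-∑W (suc k) f f∈ = InIdeal-∑ d _ (λ x → InIdeal-∑W k (λ v → f (x ∷ v)) (λ v → f∈ (x ∷ v)))

  InIdeal-ξ· : ∀ {n} s (f : Hom d n) → InIdeal p cf f → InIdeal p cf (ξ s · f)
  InIdeal-ξ· s f (ts , f≈ts) = List.map (prefixTerm s) ts , λ where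
    (x ∷ z) → toMod (≈-trans (*-congˡ≈ (δ s x) (fromMod {f z} (f≈ts z)))
                             (≈-reflexive (sym (evalTerms-prefix s ts x z))))

  InIdeal-ρ-term : ∀ {b} k (v : Word d b) → InIdeal p cf (evalTerm cf (ρ-term k v))
  InIdeal-ρ-term k v = ρ-term k v ∷ [] , λ w → toMod (≈-reflexive (sym (+-identityʳ (evalTerm cf (ρ-term k v) w))))

module NormalForm (p : ℕ) {d m : ℕ} (inA : Fin d → Bool) (cf : Coeffs d m)
  (E : Echelon.EchelonBasis p inA (ρcoef cf))
  (ρ-A-A : ∀ k x y → inA x ≡ true → inA y ≡ true → Congruence._≈_ p (ρcoef cf k x y) (+ 0)) where

  open Congruence p
  open Echelon p inA
  open IdealClosure p cf
  open EchelonBasis E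

  δ-A-B : ∀ {x y} → inA x ≡ true → inA y ≡ false → δ x y ≡ + 0
  δ-A-B {x} {y} x∈A y∈B = δ-≢ {i = x} {y} (λ { refl → true≢false (trans (sym x∈A) y∈B) })

  basis-A-A : ∀ j x y → inA x ≡ true → inA y ≡ true → basis j x y ≈ + 0
  basis-A-A j x y x∈A y∈A =
    ≈-trans (combination (basis∈span j) x y)
            (∑-≈0 m (λ k → *-≈0ʳ (coefficients (basis∈span j) k) (ρ-A-A k x y x∈A y∈A)))

  atPivot : Fin d → Fin d → Fin m → ℤ
  atPivot x y j = δ x (pivotA j) * δ y (pivotB j)

  -- Rewriting ξ_{pivotA j} ξ_{pivotB j} to ξ_{pivotA j} ξ_{pivotB j} - basis j
  -- removes the pivot words.  leftNF x w is the normal form of ξ_x w for a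
  -- normal word w, and quadNF c w that of (Σ c s t ξ_s ξ_t) w.
  mutual
    leftNF : ∀ {n} → Fin d → Word d n → Hom d (suc n)
    leftNF x []      z = ind (x ∷ []) z
    leftNF x (y ∷ w) z = ind (x ∷ y ∷ w) z - ∑ m (λ j → atPivot x y j * quadNF (basis j) w z)

    quadNF : ∀ {n} → Quadratic → Word d n → Hom d (suc (suc n))
    quadNF c w z = ∑² (λ s t → c s t * (ξ s · leftNF t w) z)

  mulNF : ∀ {n} → Fin d → Hom d n → Hom d (suc n)
  mulNF {n} x f z = ∑W n (λ w → f w * leftNF x w z)

  NF : ∀ {n} → Word d n → Hom d n
  NF []      = ind []
  NF (x ∷ w) = mulNF x (NF w)

  atPivot-B : ∀ {x} y j → inA x ≡ false → atPivot x y j ≡ + 0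
  atPivot-B {x} y j x∈B =
    trans (cong (_* δ y (pivotB j)) (trans (δ-sym x (pivotA j)) (δ-A-B (pivotA∈A j) x∈B))) (*-zeroˡ (δ y (pivotB j)))

  ∑-atPivot-B : ∀ {x} y (f : Fin m → ℤ) → inA x ≡ false → ∑ m (λ j → atPivot x y j * f j) ≡ + 0
  ∑-atPivot-B y f x∈B = trans (∑-cong m (λ j → trans (cong (_* f j) (atPivot-B y j x∈B)) (*-zeroˡ (f j)))) (∑-0 m)

  leftNF-B : ∀ {n} t (w : Word d n) z → inA t ≡ false → leftNF t w z ≡ ind (t ∷ w) z
  leftNF-B t []      z t∈B = refl
  leftNF-B t (y ∷ w) z t∈B =
    trans (cong (_-_ (ind (t ∷ y ∷ w) z)) (∑-atPivot-B y (λ j → quadNF (basis j) w z) t∈B)) (+-identityʳ _)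

  mulNF-cong : ∀ {n} x {f g : Hom d n} → (∀ w → f w ≡ g w) → ∀ z → mulNF x f z ≡ mulNF x g z
  mulNF-cong {n} x f≗g z = ∑W-cong n (λ w → cong (_* leftNF x w z) (f≗g w))

  mulNF-ind : ∀ {n} x (u : Word d n) z → mulNF x (ind u) z ≡ leftNF x u z
  mulNF-ind {n} x u z = ∑W-ind′ n u (λ w → leftNF x w z)

  mulNF-* : ∀ {n} x c (f : Hom d n) z → mulNF x (λ w → c * f w) z ≡ c * mulNF x f z
  mulNF-* {n} x c f z = trans (∑W-cong n (λ w → *-assoc c (f w) _)) (sym (∑W-*ˡ n c _))

  mulNF-∑ : ∀ {n} x k (f : Fin k → Hom d n) z → mulNF x (λ w → ∑ k (λ i → f i w)) z ≡ ∑ k (λ i → mulNF x (f i) z)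
  mulNF-∑ {n} x k f z =
    trans (∑W-cong n (λ w → ∑-*ʳ k (λ i → f i w) (leftNF x w z))) (∑W-∑ n k (λ w i → f i w * leftNF x w z))

  mulNF-∑² : ∀ {n} x (c : Quadratic) (f : Fin d → Fin d → Hom d n) z →
             mulNF x (λ w → ∑² (λ s t → c s t * f s t w)) z ≡ ∑² (λ s t → c s t * mulNF x (f s t) z)
  mulNF-∑² x c f z =
    trans (mulNF-∑ x d _ z) (∑-cong d (λ s → trans (mulNF-∑ x d _ z) (∑-cong d (λ t → mulNF-* x (c s t) (f s t) z))))

  mulNF-≈0 : ∀ {n} x (f : Hom d n) → (∀ w → f w ≈ + 0) → ∀ z → mulNF x f z ≈ + 0
  mulNF-≈0 {n} x f f≈0 z = ∑W-≈0 n (λ w → *-≈0ˡ (leftNF x w z) (f≈0 w))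

  mulNF-B : ∀ {n} s (f : Hom d n) z → inA s ≡ false → mulNF s f z ≡ (ξ s · f) z
  mulNF-B {n} s f (x ∷ z) s∈B = begin
    ∑W n (λ w → f w * leftNF s w (x ∷ z))
      ≡⟨ ∑W-cong n (λ w → cong (f w *_) (trans (leftNF-B s w (x ∷ z) s∈B) (ind-∷ s x w z))) ⟩
    ∑W n (λ w → f w * (δ s x * ind w z))  ≡⟨ ∑W-cong n (λ w → lemma (f w) (δ s x) (ind w z)) ⟩
    ∑W n (λ w → δ s x * (ind w z * f w))  ≡⟨ sym (∑W-*ˡ n (δ s x) _) ⟩
    δ s x * ∑W n (λ w → ind w z * f w)    ≡⟨ cong (δ s x *_) (∑W-ind n z f) ⟩
    δ s x * f z                           ∎
    where
    open ≡-Reasoning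
    lemma : ∀ a b c → a * (b * c) ≡ b * (c * a)
    lemma = solve-∀

  mulNF-mulNF : ∀ {n} s t (f : Hom d n) z → mulNF s (mulNF t f) z ≡ ∑W n (λ w → f w * mulNF s (leftNF t w) z)
  mulNF-mulNF {n} s t f z = begin
    ∑W (suc n) (λ w′ → ∑W n (λ w → f w * leftNF t w w′) * leftNF s w′ z)
      ≡⟨ ∑W-cong (suc n) (λ w′ → trans (∑W-*ʳ n (λ w → f w * leftNF t w w′) (leftNF s w′ z))
                                       (∑W-cong n (λ w → *-assoc (f w) (leftNF t w w′) (leftNF s w′ z)))) ⟩
    ∑W (suc n) (λ w′ → ∑W n (λ w → f w * (leftNF t w w′ * leftNF s w′ z)))
      ≡⟨ ∑W-swap (suc n) n (λ w′ w → f w * (leftNF t w w′ * leftNF s w′ z)) ⟩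
    ∑W n (λ w → ∑W (suc n) (λ w′ → f w * (leftNF t w w′ * leftNF s w′ z)))
      ≡⟨ ∑W-cong n (λ w → sym (∑W-*ˡ (suc n) (f w) (λ w′ → leftNF t w w′ * leftNF s w′ z))) ⟩
    ∑W n (λ w → f w * mulNF s (leftNF t w) z) ∎
    where open ≡-Reasoning

  quadNF-∷ : ∀ {n} c (w : Word d n) z₀ z → quadNF c w (z₀ ∷ z) ≡ ∑ d (λ t → c z₀ t * leftNF t w z)
  quadNF-∷ c w z₀ z = begin
    ∑² (λ s t → c s t * (δ s z₀ * leftNF t w z))     ≡⟨ ∑-cong d (λ s → trans (∑-cong d (λ t → lemma (c s t) (δ s z₀) (leftNF t w z)))
                                                                    (sym (∑-*ˡ d (δ s z₀) (λ t → c s t * leftNF t w z)))) ⟩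
    ∑ d (λ s → δ s z₀ * ∑ d (λ t → c s t * leftNF t w z)) ≡⟨ ∑-δ d z₀ (λ s → ∑ d (λ t → c s t * leftNF t w z)) ⟩
    ∑ d (λ t → c z₀ t * leftNF t w z)                ∎
    where
    open ≡-Reasoning
    lemma : ∀ a b c → a * (b * c) ≡ b * (a * c)
    lemma = solve-∀

  quadNF-- : ∀ {n} c c′ (w : Word d n) z → quadNF c w z - quadNF c′ w z ≡ quadNF (λ s t → c s t - c′ s t) w z
  quadNF-- c c′ w z = trans (sym (∑²-- (λ s t → c s t * X s t) (λ s t → c′ s t * X s t)))
                            (∑²-cong (λ s t → sym (*-distribʳ-- (X s t) (c s t) (c′ s t))))
    where
    X : Fin d → Fin d → ℤ
    X s t = (ξ s · leftNF t w) z
    *-distribʳ-- : ∀ a b c → (b - c) * a ≡ b * a - c * a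
    *-distribʳ-- = solve-∀

  quadNF-∑ : ∀ {n} k (a : Fin k → ℤ) (c : Fin k → Quadratic) (w : Word d n) z →
             ∑ k (λ j → a j * quadNF (c j) w z) ≡ quadNF (λ s t → ∑ k (λ j → a j * c j s t)) w z
  quadNF-∑ k a c w z = begin
    ∑ k (λ j → a j * ∑² (λ s t → c j s t * X s t))
      ≡⟨ ∑-cong k (λ j → trans (∑²-*ˡ (a j) (λ s t → c j s t * X s t))
                               (∑²-cong (λ s t → sym (*-assoc (a j) (c j s t) (X s t))))) ⟩
    ∑ k (λ j → ∑² (λ s t → a j * c j s t * X s t))
      ≡⟨ sym (∑²-∑ k (λ s t j → a j * c j s t * X s t)) ⟩
    ∑² (λ s t → ∑ k (λ j → a j * c j s t * X s t))
      ≡⟨ ∑²-cong (λ s t → sym (∑-*ʳ k (λ j → a j * c j s t) (X s t))) ⟩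
    ∑² (λ s t → ∑ k (λ j → a j * c j s t) * X s t) ∎
    where
    open ≡-Reasoning
    X : Fin d → Fin d → ℤ
    X s t = (ξ s · leftNF t w) z

  quadNF-≈0 : ∀ {n} c (w : Word d n) z → (∀ s t → c s t ≈ + 0) → quadNF c w z ≈ + 0
  quadNF-≈0 c w z c≈0 = ∑²-≈0 (λ s t → *-≈0ˡ ((ξ s · leftNF t w) z) (c≈0 s t))

  ∑²-atPivot : ∀ (c : Quadratic) (q : Fin m → ℤ) →
               ∑² (λ s t → c s t * ∑ m (λ j → atPivot s t j * q j)) ≡ ∑ m (λ j → c (pivotA j) (pivotB j) * q j)
  ∑²-atPivot c q = begin
    ∑² (λ s t → c s t * ∑ m (λ j → atPivot s t j * q j))
      ≡⟨ ∑²-cong (λ s t → ∑-*ˡ m (c s t) (λ j → atPivot s t j * q j)) ⟩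
    ∑² (λ s t → ∑ m (λ j → c s t * (atPivot s t j * q j)))
      ≡⟨ ∑²-∑ m (λ s t j → c s t * (atPivot s t j * q j)) ⟩
    ∑ m (λ j → ∑² (λ s t → c s t * (atPivot s t j * q j)))
      ≡⟨ ∑-cong m (λ j → trans (∑²-cong (λ s t → lemma (c s t) (atPivot s t j) (q j)))
                                (∑²-δ (λ s t → c s t * q j) (pivotA j) (pivotB j))) ⟩
    ∑ m (λ j → c (pivotA j) (pivotB j) * q j) ∎
    where
    open ≡-Reasoning
    lemma : ∀ a b c → a * (b * c) ≡ b * (a * c)
    lemma = solve-∀

  -- Unless both letters lie in A, ξ_s · leftNF t w needs at most the one
  -- rewriting step at its head.
  mulNF-leftNF : ∀ {n} s t (w : Word d n) z → inA s ≡ false ⊎ inA t ≡ false →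
    mulNF s (leftNF t w) z ≡ (ξ s · leftNF t w) z - ∑ m (λ j → atPivot s t j * quadNF (basis j) w z)
  mulNF-leftNF s t w z (inj₁ s∈B) = begin
    mulNF s (leftNF t w) z
      ≡⟨ mulNF-B s (leftNF t w) z s∈B ⟩
    (ξ s · leftNF t w) z
      ≡⟨ sym (+-identityʳ _) ⟩
    (ξ s · leftNF t w) z - + 0
      ≡⟨ cong (_-_ ((ξ s · leftNF t w) z)) (sym (∑-atPivot-B t (λ j → quadNF (basis j) w z) s∈B)) ⟩
    (ξ s · leftNF t w) z - ∑ m (λ j → atPivot s t j * quadNF (basis j) w z) ∎
    where open ≡-Reasoning
  mulNF-leftNF s t w (z₀ ∷ z) (inj₂ t∈B) = begin
    mulNF s (leftNF t w) (z₀ ∷ z)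
      ≡⟨ mulNF-cong s (λ v → leftNF-B t w v t∈B) (z₀ ∷ z) ⟩
    mulNF s (ind (t ∷ w)) (z₀ ∷ z)
      ≡⟨ mulNF-ind s (t ∷ w) (z₀ ∷ z) ⟩
    ind (s ∷ t ∷ w) (z₀ ∷ z) - Σpivots
      ≡⟨ cong (_- Σpivots) (trans (ind-∷ s z₀ (t ∷ w) z) (cong (δ s z₀ *_) (sym (leftNF-B t w z t∈B)))) ⟩
    δ s z₀ * leftNF t w z - Σpivots ∎
    where
    open ≡-Reasoning
    Σpivots = ∑ m (λ j → atPivot s t j * quadNF (basis j) w (z₀ ∷ z))

  -- Summed against ρ_k, the rewriting steps reassemble by expansion into
  -- quadNF of ρ_k - Σ_j ρ_k(pivot j) basis_j ≈ 0.
  ρ-mulNF-leftNF≈0 : ∀ {n} k (w : Word d n) z → ∑² (λ s t → ρ k s t * mulNF s (leftNF t w) z) ≈ + 0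
  ρ-mulNF-leftNF≈0 k w z = begin
    ∑² (λ s t → ρ k s t * mulNF s (leftNF t w) z)
      ≈⟨ ∑²-cong≈ rewrite-head ⟩
    ∑² (λ s t → ρ k s t * (X s t - ∑ m (λ j → atPivot s t j * Q j)))
      ≡⟨ ∑²-cong (λ s t → *-distribˡ-- (ρ k s t) (X s t) _) ⟩
    ∑² (λ s t → ρ k s t * X s t - ρ k s t * ∑ m (λ j → atPivot s t j * Q j))
      ≡⟨ ∑²-- (λ s t → ρ k s t * X s t) (λ s t → ρ k s t * ∑ m (λ j → atPivot s t j * Q j)) ⟩
    quadNF (ρ k) w z - ∑² (λ s t → ρ k s t * ∑ m (λ j → atPivot s t j * Q j))
      ≡⟨ cong (_-_ (quadNF (ρ k) w z)) (∑²-atPivot (ρ k) Q) ⟩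
    quadNF (ρ k) w z - ∑ m (λ j → ρ k (pivotA j) (pivotB j) * Q j)
      ≡⟨ cong (_-_ (quadNF (ρ k) w z)) (quadNF-∑ m (λ j → ρ k (pivotA j) (pivotB j)) basis w z) ⟩
    quadNF (ρ k) w z - quadNF expanded w z
      ≡⟨ quadNF-- (ρ k) expanded w z ⟩
    quadNF (λ s t → ρ k s t - expanded s t) w z
      ≈⟨ quadNF-≈0 _ w z (λ s t → ≈-trans (-‿cong≈ (expansion k s t) (≈-refl {expanded s t}))
                                          (≈-reflexive (+-inverseʳ (expanded s t)))) ⟩
    + 0 ∎
    where
    open ≈-Reasoning
    X : Fin d → Fin d → ℤ
    X s t = (ξ s · leftNF t w) z
    Q : Fin m → ℤ
    Q j = quadNF (basis j) w z
    expanded : Quadratic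
    expanded s t = ∑ m (λ j → ρ k (pivotA j) (pivotB j) * basis j s t)
    *-distribˡ-- : ∀ a b c → a * (b - c) ≡ a * b - a * c
    *-distribˡ-- = solve-∀
    rewrite-head : ∀ s t → ρ k s t * mulNF s (leftNF t w) z ≈ ρ k s t * (X s t - ∑ m (λ j → atPivot s t j * Q j))
    rewrite-head s t with inA s in s∈ | inA t in t∈
    ... | true  | true  = ≈-trans (*-≈0ˡ _ (ρ-A-A k s t s∈ t∈)) (≈-sym (*-≈0ˡ _ (ρ-A-A k s t s∈ t∈)))
    ... | false | _     = ≈-reflexive (cong (ρ k s t *_) (mulNF-leftNF s t w z (inj₁ s∈)))
    ... | true  | false = ≈-reflexive (cong (ρ k s t *_) (mulNF-leftNF s t w z (inj₂ t∈)))

  NFᴴ : ∀ {n} → Hom d n → Hom d n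
  NFᴴ {n} f z = ∑W n (λ w → f w * NF w z)

  NF-ρ-factor≈0 : ∀ {a b} (u : Word d a) (v : Word d b) k z → ∑² (λ s t → ρ k s t * NF (u ++ s ∷ t ∷ v) z) ≈ + 0
  NF-ρ-factor≈0 {b = b} [] v k z = begin
    ∑² (λ s t → ρ k s t * mulNF s (mulNF t (NF v)) z)
      ≡⟨ ∑²-cong (λ s t → trans (cong (ρ k s t *_) (mulNF-mulNF s t (NF v) z)) (∑W-*ˡ b (ρ k s t) _)) ⟩
    ∑² (λ s t → ∑W b (λ w → ρ k s t * (NF v w * M s t w)))
      ≡⟨ ∑²-∑W b (λ s t w → ρ k s t * (NF v w * M s t w)) ⟩
    ∑W b (λ w → ∑² (λ s t → ρ k s t * (NF v w * M s t w)))
      ≡⟨ ∑W-cong b (λ w → trans (∑²-cong (λ s t → lemma (ρ k s t) (NF v w) (M s t w)))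
                                (sym (∑²-*ˡ (NF v w) (λ s t → ρ k s t * M s t w)))) ⟩
    ∑W b (λ w → NF v w * ∑² (λ s t → ρ k s t * M s t w))
      ≈⟨ ∑W-≈0 b (λ w → *-≈0ʳ (NF v w) (ρ-mulNF-leftNF≈0 k w z)) ⟩
    + 0 ∎
    where
    open ≈-Reasoning
    M : Fin d → Fin d → Word d b → ℤ
    M s t w = mulNF s (leftNF t w) z
    lemma : ∀ a b c → a * (b * c) ≡ b * (a * c)
    lemma = solve-∀
  NF-ρ-factor≈0 (x ∷ u) v k z =
    ≈-trans (≈-reflexive (sym (mulNF-∑² x (ρ k) (λ s t → NF (u ++ s ∷ t ∷ v)) z)))
            (mulNF-≈0 x _ (λ z′ → NF-ρ-factor≈0 u v k z′) z)

  NFᴴ-gen≈0 : ∀ a b (u : Word d a) (v : Word d b) k z → NFᴴ (gen cf a b u v k) z ≈ + 0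
  NFᴴ-gen≈0 a b u v k z = begin
    ∑W (a ℕ.+ (2 ℕ.+ b)) (λ w → gen cf a b u v k w * NF w z)
      ≡⟨ ∑W-++ a (2 ℕ.+ b) _ ⟩
    ∑W a (λ u′ → ∑W (2 ℕ.+ b) (λ r → gen cf a b u v k (u′ ++ r) * NF (u′ ++ r) z))
      ≡⟨ ∑W-cong a (λ u′ → trans (∑W-cong (2 ℕ.+ b) (λ r → split u′ r))
                                 (sym (∑W-*ˡ (2 ℕ.+ b) (ind u u′) (λ r → G r * NF (u′ ++ r) z)))) ⟩
    ∑W a (λ u′ → ind u u′ * ∑W (2 ℕ.+ b) (λ r → G r * NF (u′ ++ r) z))
      ≡⟨ ∑W-ind′ a u _ ⟩
    ∑² (λ s t → ∑W b (λ v′ → ρ k s t * ind v v′ * NF (u ++ s ∷ t ∷ v′) z))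
      ≡⟨ ∑²-cong (λ s t → trans (∑W-cong b (λ v′ → lemma (ρ k s t) (ind v v′) _))
                                (∑W-ind′ b v (λ v′ → ρ k s t * NF (u ++ s ∷ t ∷ v′) z))) ⟩
    ∑² (λ s t → ρ k s t * NF (u ++ s ∷ t ∷ v) z)
      ≈⟨ NF-ρ-factor≈0 u v k z ⟩
    + 0 ∎
    where
    open ≈-Reasoning
    G : Word d (2 ℕ.+ b) → ℤ
    G r = ρ k (head r) (head (tail r)) * ind v (drop 2 r)
    split : ∀ u′ r → gen cf a b u v k (u′ ++ r) * NF (u′ ++ r) z ≡ ind u u′ * (G r * NF (u′ ++ r) z)
    split u′ r rewrite take-++ u′ r | drop-++ u′ r = *-assoc (ind u u′) (G r) (NF (u′ ++ r) z)
    lemma : ∀ a b c → a * b * c ≡ b * (a * c)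
    lemma = solve-∀

  NFᴴ-evalTerms≈0 : ∀ {n} (ts : List (Term d m n)) z → NFᴴ (evalTerms cf ts) z ≈ + 0
  NFᴴ-evalTerms≈0 {n} [] z = ≈-reflexive (trans (∑W-cong n (λ w → *-zeroˡ (NF w z))) (∑W-0 n))
  NFᴴ-evalTerms≈0 {n} (term a b refl u v k c ∷ ts) z = begin
    ∑W n (λ w → (c * gen cf a b u v k w + evalTerms cf ts w) * NF w z)
      ≡⟨ trans (∑W-cong n (λ w → *-distribʳ-+ (NF w z) (c * gen cf a b u v k w) (evalTerms cf ts w))) (∑W-+ n _ _) ⟩
    ∑W n (λ w → c * gen cf a b u v k w * NF w z) + NFᴴ (evalTerms cf ts) z
      ≡⟨ cong (_+ NFᴴ (evalTerms cf ts) z) (trans (∑W-cong n (λ w → *-assoc c _ (NF w z))) (sym (∑W-*ˡ n c _))) ⟩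
    c * NFᴴ (gen cf a b u v k) z + NFᴴ (evalTerms cf ts) z
      ≈⟨ +-cong≈ (*-≈0ʳ c (NFᴴ-gen≈0 a b u v k z)) (NFᴴ-evalTerms≈0 ts z) ⟩
    + 0 ∎
    where open ≈-Reasoning

  NFᴴ-ideal≈0 : ∀ {n} (f : Hom d n) → InIdeal p cf f → ∀ z → NFᴴ f z ≈ + 0
  NFᴴ-ideal≈0 {n} f (ts , f≈ts) z =
    ≈-trans (∑W-cong≈ n (λ w → *-congʳ≈ (NF w z) (fromMod {f w} (f≈ts w)))) (NFᴴ-evalTerms≈0 ts z)

  IsPivot : Fin d → Fin d → Set
  IsPivot x y = ∃ λ j → pivotA j ≡ x × pivotB j ≡ y

  isPivot? : ∀ x y → Dec (IsPivot x y)
  isPivot? x y = FinP.any? (λ j → pivotA j ≟ᶠ x ×-dec pivotB j ≟ᶠ y)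

  atPivot-¬IsPivot : ∀ {x y} → ¬ IsPivot x y → ∀ j → atPivot x y j ≡ + 0
  atPivot-¬IsPivot {x} {y} ¬pivot j with pivotA j ≟ᶠ x | pivotB j ≟ᶠ y
  ... | yes refl | yes refl = ⊥-elim (¬pivot (j , refl , refl))
  ... | no  a≢x  | _        = trans (cong (_* δ y (pivotB j)) (δ-≢ {i = x} (a≢x ∘ sym))) (*-zeroˡ (δ y (pivotB j)))
  ... | yes _    | no  b≢y  = trans (cong (δ x (pivotA j) *_) (δ-≢ {i = y} (b≢y ∘ sym))) (*-zeroʳ (δ x (pivotA j)))

  headNormal : ∀ {n} → Fin d → Word d n → Bool
  headNormal x []      = true
  headNormal x (y ∷ _) = not (does (isPivot? x y))

  isNormal : ∀ {n} → Word d n → Bool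
  isNormal []      = true
  isNormal (x ∷ w) = headNormal x w ∧ isNormal w

  private
    ∧-true : ∀ {a b} → a ∧ b ≡ true → a ≡ true × b ≡ true
    ∧-true {true} {true} refl = refl , refl

  leftNF-headNormal : ∀ {n} x (w : Word d n) z → headNormal x w ≡ true → leftNF x w z ≡ ind (x ∷ w) z
  leftNF-headNormal x []      z _ = refl
  leftNF-headNormal x (y ∷ w) z normal with isPivot? x y | normal
  ... | yes _     | ()
  ... | no ¬pivot | _ = begin
    ind (x ∷ y ∷ w) z - ∑ m (λ j → atPivot x y j * quadNF (basis j) w z)
      ≡⟨ cong (_-_ (ind (x ∷ y ∷ w) z)) (trans (∑-cong m (λ j → trans (cong (_* quadNF (basis j) w z) (atPivot-¬IsPivot ¬pivot j))
                                                                           (*-zeroˡ (quadNF (basis j) w z)))) (∑-0 m)) ⟩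
    ind (x ∷ y ∷ w) z - + 0
      ≡⟨ +-identityʳ _ ⟩
    ind (x ∷ y ∷ w) z ∎
    where open ≡-Reasoning

  NF-normal : ∀ {n} (u : Word d n) → isNormal u ≡ true → ∀ z → NF u z ≡ ind u z
  NF-normal []      _      z = refl
  NF-normal (x ∷ u) normal z =
    trans (mulNF-cong x (NF-normal u (proj₂ (∧-true normal))) z)
          (trans (mulNF-ind x u z) (leftNF-headNormal x u z (proj₁ (∧-true normal))))

  quadNF-basis-at-pivot : ∀ {n} j l (w : Word d n) z →
                          quadNF (basis j) w (pivotA l ∷ pivotB l ∷ z) ≈ δ j l * ind w z
  quadNF-basis-at-pivot j l w z = begin
    quadNF (basis j) w (pivotA l ∷ pivotB l ∷ z)
      ≡⟨ quadNF-∷ (basis j) w (pivotA l) (pivotB l ∷ z) ⟩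
    ∑ d (λ t → basis j (pivotA l) t * leftNF t w (pivotB l ∷ z))
      ≈⟨ ∑-cong≈ d second-letter ⟩
    ∑ d (λ t → basis j (pivotA l) t * (δ t (pivotB l) * ind w z))
      ≡⟨ trans (∑-cong d (λ t → lemma (basis j (pivotA l) t) (δ t (pivotB l)) (ind w z))) (∑-δ d (pivotB l) _) ⟩
    basis j (pivotA l) (pivotB l) * ind w z
      ≈⟨ *-congʳ≈ (ind w z) (basis-at-pivot j l) ⟩
    δ j l * ind w z ∎
    where
    open ≈-Reasoning
    lemma : ∀ a b c → a * (b * c) ≡ b * (a * c)
    lemma = solve-∀
    second-letter : ∀ t → basis j (pivotA l) t * leftNF t w (pivotB l ∷ z) ≈ basis j (pivotA l) t * (δ t (pivotB l) * ind w z)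
    second-letter t with inA t in t∈
    ... | false = ≈-reflexive (cong (basis j (pivotA l) t *_) (trans (leftNF-B t w _ t∈) (ind-∷ t (pivotB l) w z)))
    ... | true  = ≈-trans (*-≈0ˡ _ A-A) (≈-sym (*-≈0ˡ _ A-A))
      where A-A = basis-A-A j (pivotA l) t (pivotA∈A l) t∈

  ind-normal-abnormal : ∀ {n} {u v : Word d n} → isNormal u ≡ true → isNormal v ≡ false → ind u v ≡ + 0
  ind-normal-abnormal {u = u} {v} u-normal v-abnormal =
    ind-≢ {u = u} {v} (λ { refl → true≢false (trans (sym u-normal) v-abnormal) })

  -- Either the tail of z is already abnormal, or z starts with a pivot
  -- word, which leftNF has rewritten away.
  leftNF-supported : ∀ {n} x (w : Word d n) z → isNormal w ≡ true → isNormal z ≡ false → leftNF x w z ≈ + 0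
  leftNF-supported x []      (z₀ ∷ [])     _      ()
  leftNF-supported x (y ∷ w) (z₀ ∷ z₁ ∷ z) normal abnormal with isNormal (z₁ ∷ z) in tail-normal?
  ... | false = -‿cong≈ (≈-reflexive ind≡0) (∑-≈0 m (λ j → *-≈0ʳ (atPivot x y j) quadNF≈0)) 
    where
    ind≡0 : ind (x ∷ y ∷ w) (z₀ ∷ z₁ ∷ z) ≡ + 0
    ind≡0 = trans (ind-∷ x z₀ (y ∷ w) (z₁ ∷ z))
                  (trans (cong (δ x z₀ *_) (ind-normal-abnormal {u = y ∷ w} {z₁ ∷ z} normal tail-normal?)) (*-zeroʳ (δ x z₀)))
    quadNF≈0 : ∀ {j} → quadNF (basis j) w (z₀ ∷ z₁ ∷ z) ≈ + 0
    quadNF≈0 {j} = ≈-trans (≈-reflexive (quadNF-∷ (basis j) w z₀ (z₁ ∷ z)))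
      (∑-≈0 d (λ t → *-≈0ʳ (basis j z₀ t) (leftNF-supported t w (z₁ ∷ z) (proj₂ (∧-true normal)) tail-normal?)))
  ... | true with isPivot? z₀ z₁ | abnormal
  ...   | no _               | ()
  ...   | yes (l , refl , refl) | _ = begin
    ind (x ∷ y ∷ w) (pivotA l ∷ pivotB l ∷ z) - ∑ m (λ j → atPivot x y j * quadNF (basis j) w (pivotA l ∷ pivotB l ∷ z))
      ≈⟨ -‿cong≈ (≈-refl {ind (x ∷ y ∷ w) (pivotA l ∷ pivotB l ∷ z)})
                 (∑-cong≈ m (λ j → *-congˡ≈ (atPivot x y j) (quadNF-basis-at-pivot j l w z))) ⟩
    ind (x ∷ y ∷ w) (pivotA l ∷ pivotB l ∷ z) - ∑ m (λ j → atPivot x y j * (δ j l * ind w z))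
      ≡⟨ cong (_-_ (ind (x ∷ y ∷ w) (pivotA l ∷ pivotB l ∷ z)))
              (trans (∑-cong m (λ j → lemma (atPivot x y j) (δ j l) (ind w z))) (∑-δ m l (λ j → atPivot x y j * ind w z))) ⟩
    ind (x ∷ y ∷ w) (pivotA l ∷ pivotB l ∷ z) - atPivot x y l * ind w z
      ≡⟨ cong (_- atPivot x y l * ind w z) ind-pivot ⟩
    atPivot x y l * ind w z - atPivot x y l * ind w z
      ≡⟨ +-inverseʳ (atPivot x y l * ind w z) ⟩
    + 0 ∎
    where
    open ≈-Reasoning
    lemma : ∀ a b c → a * (b * c) ≡ b * (a * c)
    lemma = solve-∀
    ind-pivot : ind (x ∷ y ∷ w) (pivotA l ∷ pivotB l ∷ z) ≡ atPivot x y l * ind w z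
    ind-pivot = trans (ind-∷ x (pivotA l) (y ∷ w) (pivotB l ∷ z))
      (trans (cong (δ x (pivotA l) *_) (ind-∷ y (pivotB l) w z)) (sym (*-assoc (δ x (pivotA l)) (δ y (pivotB l)) (ind w z))))

  NF-supported : ∀ {n} (w : Word d n) z → isNormal z ≡ false → NF w z ≈ + 0
  NF-supported []              []  ()
  NF-supported {suc n} (x ∷ w) z abnormal = ∑W-≈0 n summand≈0
    where
    summand≈0 : ∀ w′ → NF w w′ * leftNF x w′ z ≈ + 0
    summand≈0 w′ with isNormal w′ in normal?
    ... | true  = *-≈0ʳ (NF w w′) (leftNF-supported x w′ z normal? abnormal)
    ... | false = *-≈0ˡ (leftNF x w′ z) (NF-supported w w′ normal?)

  -- basis j · w is in the ideal because basis j is a combination of the ρ_k.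
  basis·w∈I : ∀ {n} j (w : Word d n) → InIdeal p cf (λ z → ∑² (λ s t → basis j s t * (δ s (head z) * ind (t ∷ w) (tail z))))
  basis·w∈I {n} j w = InIdeal-cong _ _ value
    (InIdeal-∑ m _ (λ k → InIdeal-* (coefficients (basis∈span j) k) _ (InIdeal-ρ-term k w)))
    where
    value : ∀ z → ∑ m (λ k → coefficients (basis∈span j) k * evalTerm cf (ρ-term k w) z)
                  ≈ ∑² (λ s t → basis j s t * (δ s (head z) * ind (t ∷ w) (tail z)))
    value (z₀ ∷ z₁ ∷ z) = begin
      ∑ m (λ k → c k * evalTerm cf (ρ-term k w) (z₀ ∷ z₁ ∷ z))
        ≡⟨ ∑-cong m (λ k → trans (cong (c k *_) (ρ-term-value k w z₀ z₁ z))
                                 (sym (*-assoc (c k) (ρ k z₀ z₁) (ind w z)))) ⟩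
      ∑ m (λ k → c k * ρ k z₀ z₁ * ind w z)
        ≡⟨ sym (∑-*ʳ m (λ k → c k * ρ k z₀ z₁) (ind w z)) ⟩
      ∑ m (λ k → c k * ρ k z₀ z₁) * ind w z
        ≈⟨ *-congʳ≈ (ind w z) (≈-sym (combination (basis∈span j) z₀ z₁)) ⟩
      basis j z₀ z₁ * ind w z
        ≡⟨ sym (∑²-δ (λ s t → basis j s t * ind w z) z₀ z₁) ⟩
      ∑² (λ s t → (δ s z₀ * δ t z₁) * (basis j s t * ind w z))
        ≡⟨ ∑²-cong (λ s t → trans (lemma (δ s z₀) (δ t z₁) (basis j s t) (ind w z))
                                  (cong (λ e → basis j s t * (δ s z₀ * e)) (sym (ind-∷ t z₁ w z)))) ⟩
      ∑² (λ s t → basis j s t * (δ s z₀ * ind (t ∷ w) (z₁ ∷ z))) ∎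
      where
      open ≈-Reasoning
      c = coefficients (basis∈span j)
      lemma : ∀ a b c e → (a * b) * (c * e) ≡ c * (a * (b * e))
      lemma = solve-∀

  mutual
    ind-leftNF∈I : ∀ {n} x (w : Word d n) → InIdeal p cf (λ z → ind (x ∷ w) z - leftNF x w z)
    ind-leftNF∈I x []      = InIdeal-≈0 _ (λ z → ≈-reflexive (+-inverseʳ (ind (x ∷ []) z)))
    ind-leftNF∈I {suc n} x (y ∷ w) = InIdeal-cong corrections _ (λ z → ≈-reflexive (sym (lemma (ind (x ∷ y ∷ w) z) (corrections z))))
      (InIdeal-∑ m (λ j z → atPivot x y j * quadNF (basis j) w z)
                   (λ j → InIdeal-* (atPivot x y j) (quadNF (basis j) w) (quadNF-basis∈I j w)))
      where
      corrections : Hom d (suc (suc n))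
      corrections z = ∑ m (λ j → atPivot x y j * quadNF (basis j) w z)
      lemma : ∀ a b → a - (a - b) ≡ b
      lemma = solve-∀

    -- quadNF (basis j) w = basis j · w - Σ basis j s t ξ_s (t w - leftNF t w).
    quadNF-basis∈I : ∀ {n} j (w : Word d n) → InIdeal p cf (quadNF (basis j) w)
    quadNF-basis∈I {n} j w = InIdeal-cong (λ z → basis·w z - corrections z) (quadNF (basis j) w) difference
      (InIdeal-- basis·w corrections (basis·w∈I j w)
        (InIdeal-∑ d (λ s z → ∑ d (λ t → correction s t z)) (λ s →
          InIdeal-∑ d (λ t → correction s t) (λ t →
            InIdeal-* (basis j s t) (ξ s · defect t) (InIdeal-ξ· s (defect t) (ind-leftNF∈I t w))))))
      where
      defect : Fin d → Hom d (suc n)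
      defect t z = ind (t ∷ w) z - leftNF t w z
      correction : Fin d → Fin d → Hom d (suc (suc n))
      correction s t z = basis j s t * (ξ s · defect t) z
      basis·w corrections : Hom d (suc (suc n))
      basis·w z = ∑² (λ s t → basis j s t * (δ s (head z) * ind (t ∷ w) (tail z)))
      corrections z = ∑² (λ s t → correction s t z)
      lemma : ∀ b e i l → b * (e * i) - b * (e * (i - l)) ≡ b * (e * l)
      lemma = solve-∀
      difference : ∀ z → basis·w z - corrections z ≈ quadNF (basis j) w z
      difference z = ≈-reflexive (trans (sym (∑²-- (λ s t → basis j s t * (δ s (head z) * ind (t ∷ w) (tail z)))
                                                    (λ s t → correction s t z)))
        (∑²-cong (λ s t → lemma (basis j s t) (δ s (head z)) (ind (t ∷ w) (tail z)) (leftNF t w (tail z)))))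

  ind-NF∈I : ∀ {n} (w : Word d n) → InIdeal p cf (λ z → ind w z - NF w z)
  ind-NF∈I []              = InIdeal-≈0 _ (λ z → ≈-reflexive (+-inverseʳ (ind [] z)))
  ind-NF∈I {suc n} (x ∷ w) = InIdeal-cong (λ z → (ξ x · defect) z + corrections z) _ (λ z → ≈-reflexive (decomposition z))
    (InIdeal-+ (ξ x · defect) corrections (InIdeal-ξ· x defect (ind-NF∈I w))
      (InIdeal-∑W n (λ w′ z → NF w w′ * leftDefect w′ z)
                    (λ w′ → InIdeal-* (NF w w′) (leftDefect w′) (ind-leftNF∈I x w′))))
    where
    defect : Hom d n
    defect z = ind w z - NF w z
    leftDefect : Word d n → Hom d (suc n)
    leftDefect w′ z = ind (x ∷ w′) z - leftNF x w′ z
    corrections : Hom d (suc n)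
    corrections z = ∑W n (λ w′ → NF w w′ * leftDefect w′ z)
    decomposition : ∀ z → (ξ x · defect) z + corrections z ≡ ind (x ∷ w) z - mulNF x (NF w) z
    decomposition (z₀ ∷ z) = begin
      δ x z₀ * (ind w z - NF w z) + ∑W n (λ w′ → NF w w′ * (ind (x ∷ w′) (z₀ ∷ z) - leftNF x w′ (z₀ ∷ z)))
        ≡⟨ cong (_+_ (δ x z₀ * (ind w z - NF w z)))
                (trans (∑W-cong n (λ w′ → *-distribˡ-- (NF w w′) _ _)) (∑W-- n _ _)) ⟩
      δ x z₀ * (ind w z - NF w z) + (∑W n (λ w′ → NF w w′ * ind (x ∷ w′) (z₀ ∷ z)) - mulNF x (NF w) (z₀ ∷ z))
        ≡⟨ cong (λ e → δ x z₀ * (ind w z - NF w z) + (e - mulNF x (NF w) (z₀ ∷ z))) NF-prefix ⟩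
      δ x z₀ * (ind w z - NF w z) + (δ x z₀ * NF w z - mulNF x (NF w) (z₀ ∷ z))
        ≡⟨ cancel (δ x z₀) (ind w z) (NF w z) (mulNF x (NF w) (z₀ ∷ z)) ⟩
      δ x z₀ * ind w z - mulNF x (NF w) (z₀ ∷ z)
        ≡⟨ cong (_- mulNF x (NF w) (z₀ ∷ z)) (sym (ind-∷ x z₀ w z)) ⟩
      ind (x ∷ w) (z₀ ∷ z) - mulNF x (NF w) (z₀ ∷ z) ∎
      where
      open ≡-Reasoning
      *-distribˡ-- : ∀ a b c → a * (b - c) ≡ a * b - a * c
      *-distribˡ-- = solve-∀
      cancel : ∀ a b c l → a * (b - c) + (a * c - l) ≡ a * b - l
      cancel = solve-∀
      lemma : ∀ a b c → a * (b * c) ≡ b * (c * a)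
      lemma = solve-∀
      NF-prefix : ∑W n (λ w′ → NF w w′ * ind (x ∷ w′) (z₀ ∷ z)) ≡ δ x z₀ * NF w z
      NF-prefix = begin
        ∑W n (λ w′ → NF w w′ * ind (x ∷ w′) (z₀ ∷ z))
          ≡⟨ ∑W-cong n (λ w′ → trans (cong (NF w w′ *_) (ind-∷ x z₀ w′ z)) (lemma (NF w w′) (δ x z₀) (ind w′ z))) ⟩
        ∑W n (λ w′ → δ x z₀ * (ind w′ z * NF w w′))    ≡⟨ sym (∑W-*ˡ n (δ x z₀) _) ⟩
        δ x z₀ * ∑W n (λ w′ → ind w′ z * NF w w′)      ≡⟨ cong (δ x z₀ *_) (∑W-ind n z (NF w)) ⟩
        δ x z₀ * NF w z                                ∎

  f-NFᴴ∈I : ∀ {n} (f : Hom d n) → InIdeal p cf (λ z → f z - NFᴴ f z)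
  f-NFᴴ∈I {n} f = InIdeal-cong (λ z → ∑W n (λ w → f w * (ind w z - NF w z))) _ (λ z → ≈-reflexive (decomposition z))
    (InIdeal-∑W n (λ w z → f w * (ind w z - NF w z)) (λ w → InIdeal-* (f w) _ (ind-NF∈I w)))
    where
    *-distribˡ-- : ∀ a b c → a * (b - c) ≡ a * b - a * c
    *-distribˡ-- = solve-∀
    decomposition : ∀ z → ∑W n (λ w → f w * (ind w z - NF w z)) ≡ f z - NFᴴ f z
    decomposition z = begin
      ∑W n (λ w → f w * (ind w z - NF w z))              ≡⟨ ∑W-cong n (λ w → *-distribˡ-- (f w) (ind w z) (NF w z)) ⟩
      ∑W n (λ w → f w * ind w z - f w * NF w z)          ≡⟨ ∑W-- n _ _ ⟩
      ∑W n (λ w → f w * ind w z) - NFᴴ f z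
        ≡⟨ cong (_- NFᴴ f z) (trans (∑W-cong n (λ w → *-comm (f w) (ind w z))) (∑W-ind n z f)) ⟩
      f z - NFᴴ f z                                      ∎
      where open ≡-Reasoning

  χ : ∀ {n} → Word d n → ℤ
  χ w = if isNormal w then + 1 else + 0

  #normal : ℕ → ℤ
  #normal n = ∑W {d} n χ

  ¬IsPivot-B : ∀ {x} y → inA x ≡ false → ¬ IsPivot x y
  ¬IsPivot-B y x∈B (l , refl , _) = true≢false (trans (sym (pivotA∈A l)) x∈B)

  isNormal-B∷ : ∀ {n} y (w : Word d n) → inA y ≡ false → isNormal (y ∷ w) ≡ isNormal w
  isNormal-B∷ y []      y∈B = refl
  isNormal-B∷ y (z ∷ w) y∈B rewrite dec-false (isPivot? y z) (¬IsPivot-B z y∈B) = refl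

  -- Pivot words cannot overlap, since their first letter is in A and their
  -- second in B; so x y w is normal iff y w is, unless x y is a pivot word.
  χ-∷∷ : ∀ {n} x y (w : Word d n) → χ (x ∷ y ∷ w) ≡ χ (y ∷ w) - 𝟙 (isPivot? x y) * χ w
  χ-∷∷ x y w with isPivot? x y
  ... | no _ with isNormal (y ∷ w)
  ...   | true  = refl
  ...   | false = refl
  χ-∷∷ x y w | yes (l , refl , refl) rewrite isNormal-B∷ (pivotB l) w (pivotB∈B l) with isNormal w
  ...   | true  = refl
  ...   | false = refl

  module Counting (1≉0 : ¬ + 1 ≈ + 0) where

    pivot-injective : ∀ j l → pivotA j ≡ pivotA l → pivotB j ≡ pivotB l → j ≡ l
    pivot-injective j l a≡ b≡ with j ≟ᶠ l
    ... | yes j≡l = j≡l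
    ... | no  j≢l = ⊥-elim (1≉0 (begin
      + 1                             ≡⟨ sym (δ-refl j) ⟩
      δ j j                           ≈⟨ ≈-sym (basis-at-pivot j j) ⟩
      basis j (pivotA j) (pivotB j)   ≡⟨ cong₂ (basis j) a≡ b≡ ⟩
      basis j (pivotA l) (pivotB l)   ≈⟨ basis-at-pivot j l ⟩
      δ j l                           ≡⟨ δ-≢ j≢l ⟩
      + 0                             ∎))
      where open ≈-Reasoning

    atPivot-pivot : ∀ l j → atPivot (pivotA l) (pivotB l) j ≡ δ j l
    atPivot-pivot l j with j ≟ᶠ l
    ... | yes refl = cong₂ _*_ (δ-refl (pivotA j)) (δ-refl (pivotB j))
    ... | no  j≢l with pivotA l ≟ᶠ pivotA j | pivotB l ≟ᶠ pivotB j
    ...   | yes a≡ | yes b≡ = ⊥-elim (j≢l (pivot-injective j l (sym a≡) (sym b≡)))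
    ...   | no _   | _      = *-zeroˡ (δ (pivotB l) (pivotB j))
    ...   | yes _  | no _   = *-zeroʳ (+ 1)

    𝟙-isPivot : ∀ x y → 𝟙 (isPivot? x y) ≡ ∑ m (atPivot x y)
    𝟙-isPivot x y with isPivot? x y
    ... | no ¬pivot = sym (trans (∑-cong m (atPivot-¬IsPivot ¬pivot)) (∑-0 m))
    ... | yes (l , refl , refl) = sym (begin
      ∑ m (atPivot (pivotA l) (pivotB l))  ≡⟨ ∑-cong m (λ j → trans (atPivot-pivot l j) (sym (*-identityʳ (δ j l)))) ⟩
      ∑ m (λ j → δ j l * + 1)              ≡⟨ ∑-δ m l (λ _ → + 1) ⟩
      + 1                                  ∎)
      where open ≡-Reasoning

    ∑²-𝟙-isPivot : ∑² (λ x y → 𝟙 (isPivot? x y)) ≡ + m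
    ∑²-𝟙-isPivot = begin
      ∑² (λ x y → 𝟙 (isPivot? x y))             ≡⟨ ∑²-cong 𝟙-isPivot ⟩
      ∑² (λ x y → ∑ m (atPivot x y))            ≡⟨ ∑²-∑ m atPivot ⟩
      ∑ m (λ j → ∑² (λ x y → atPivot x y j))    ≡⟨ ∑-cong m (λ j → trans (∑²-cong (λ x y → sym (*-identityʳ (atPivot x y j))))
                                                                         (∑²-δ (λ _ _ → + 1) (pivotA j) (pivotB j))) ⟩
      ∑ m (λ _ → + 1)                           ≡⟨ ∑-const m (+ 1) ⟩
      + m * + 1                                 ≡⟨ *-identityʳ (+ m) ⟩
      + m                                       ∎
      where open ≡-Reasoning

    #normal-recurrence : ∀ n → #normal (suc (suc n)) ≡ + d * #normal (suc n) - + m * #normal n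
    #normal-recurrence n = begin
      ∑² (λ x y → ∑W n (λ w → χ (x ∷ y ∷ w)))
        ≡⟨ ∑²-cong (λ x y → trans (∑W-cong n (χ-∷∷ x y)) (∑W-- n _ _)) ⟩
      ∑² (λ x y → ∑W n (λ w → χ (y ∷ w)) - ∑W n (λ w → 𝟙 (isPivot? x y) * χ w))
        ≡⟨ ∑²-- (λ x y → ∑W n (λ w → χ (y ∷ w))) (λ x y → ∑W n (λ w → 𝟙 (isPivot? x y) * χ w)) ⟩
      ∑ d (λ _ → #normal (suc n)) - ∑² (λ x y → ∑W n (λ w → 𝟙 (isPivot? x y) * χ w))
        ≡⟨ cong₂ _-_ (∑-const d (#normal (suc n))) (∑²-cong (λ x y → sym (∑W-*ˡ n (𝟙 (isPivot? x y)) χ))) ⟩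
      + d * #normal (suc n) - ∑² (λ x y → 𝟙 (isPivot? x y) * #normal n)
        ≡⟨ cong (_-_ (+ d * #normal (suc n))) (trans (∑-cong d (λ x → sym (∑-*ʳ d (λ y → 𝟙 (isPivot? x y)) (#normal n))))
                                                      (sym (∑-*ʳ d (λ x → ∑ d (λ y → 𝟙 (isPivot? x y))) (#normal n)))) ⟩
      + d * #normal (suc n) - ∑² (λ x y → 𝟙 (isPivot? x y)) * #normal n
        ≡⟨ cong (λ e → + d * #normal (suc n) - e * #normal n) ∑²-𝟙-isPivot ⟩
      + d * #normal (suc n) - + m * #normal n ∎
      where open ≡-Reasoning

    hilb≡#normal : ∀ n → hilb d m n ≡ #normal n × hilb d m (suc n) ≡ #normal (suc n)
    hilb≡#normal zero    = refl , trans (sym (*-identityʳ (+ d))) (sym (∑-const d (+ 1)))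
    hilb≡#normal (suc n) with hilb≡#normal n
    ... | h≡₀ , h≡₁ = h≡₁ , trans (cong₂ (λ a b → + d * a - + m * b) h≡₁ h≡₀) (sym (#normal-recurrence n))

module Enumeration where

  sumL : ∀ {A : Set} → (A → ℤ) → List A → ℤ
  sumL f = List.foldr (λ x s → f x + s) (+ 0)

  sumL-++ : ∀ {A : Set} (f : A → ℤ) xs ys → sumL f (xs ++ᴸ ys) ≡ sumL f xs + sumL f ys
  sumL-++ f []       ys = sym (+-identityˡ _)
  sumL-++ f (x ∷ xs) ys = trans (cong (_+_ (f x)) (sumL-++ f xs ys)) (sym (+-assoc (f x) _ _))

  sumL-map : ∀ {A B : Set} (f : B → ℤ) (g : A → B) xs → sumL f (List.map g xs) ≡ sumL (f ∘ g) xs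
  sumL-map f g []       = refl
  sumL-map f g (x ∷ xs) = cong (_+_ (f (g x))) (sumL-map f g xs)

  sumL-cartesianProductWith : ∀ {A B C : Set} (f : C → ℤ) (h : A → B → C) xs ys →
    sumL f (List.cartesianProductWith h xs ys) ≡ sumL (λ x → sumL (λ y → f (h x y)) ys) xs
  sumL-cartesianProductWith f h []       ys = refl
  sumL-cartesianProductWith f h (x ∷ xs) ys =
    trans (sumL-++ f (List.map (h x) ys) _) (cong₂ _+_ (sumL-map f (h x) ys) (sumL-cartesianProductWith f h xs ys))

  sumL-tabulate : ∀ {A : Set} n (f : A → ℤ) (g : Fin n → A) → sumL f (List.tabulate g) ≡ ∑ n (f ∘ g)
  sumL-tabulate zero    f g = refl
  sumL-tabulate (suc n) f g = cong (_+_ (f (g Fin.zero))) (sumL-tabulate n f (g ∘ Fin.suc))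

  ∑-lookup : ∀ {A : Set} (f : A → ℤ) (xs : List A) → ∑ (List.length xs) (f ∘ List.lookup xs) ≡ sumL f xs
  ∑-lookup f []       = refl
  ∑-lookup f (x ∷ xs) = cong (_+_ (f x)) (∑-lookup f xs)

  lookup-injective : ∀ {A : Set} (xs : List A) → Unique xs → ∀ i j → List.lookup xs i ≡ List.lookup xs j → i ≡ j
  lookup-injective (x ∷ xs) _           Fin.zero    Fin.zero    _  = refl
  lookup-injective (x ∷ xs) (x∉ AllPairs.∷ _) Fin.zero (Fin.suc j) eq = ⊥-elim (All.lookup x∉ (∈-lookup {xs = xs} j) eq)
  lookup-injective (x ∷ xs) (x∉ AllPairs.∷ _) (Fin.suc i) Fin.zero eq = ⊥-elim (All.lookup x∉ (∈-lookup {xs = xs} i) (sym eq))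
  lookup-injective (x ∷ xs) (_ AllPairs.∷ u) (Fin.suc i) (Fin.suc j) eq = cong Fin.suc (lookup-injective xs u i j eq)

  words : ∀ d n → List (Word d n)
  words d zero    = [] ∷ []
  words d (suc n) = List.cartesianProductWith _∷_ (List.allFin d) (words d n)

  words-unique : ∀ d n → Unique (words d n)
  words-unique d zero    = All.[] AllPairs.∷ AllPairs.[]
  words-unique d (suc n) = Uniqueₚ.cartesianProductWith⁺ _∷_ ∷-injective (Uniqueₚ.allFin⁺ d) (words-unique d n)

  sumL-words : ∀ {d} n (f : Word d n → ℤ) → sumL f (words d n) ≡ ∑W n f
  sumL-words zero        f = +-identityʳ (f [])
  sumL-words {d} (suc n) f = begin
    sumL f (List.cartesianProductWith _∷_ (List.allFin d) (words d n))
      ≡⟨ sumL-cartesianProductWith f _∷_ (List.allFin d) (words d n) ⟩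
    sumL (λ x → sumL (λ w → f (x ∷ w)) (words d n)) (List.allFin d)
      ≡⟨ List.foldr-cong (λ x s → cong (_+ s) (sumL-words n (λ w → f (x ∷ w)))) refl (List.allFin d) ⟩
    sumL (λ x → ∑W n (λ w → f (x ∷ w))) (List.allFin d)
      ≡⟨ sumL-tabulate d (λ x → ∑W n (λ w → f (x ∷ w))) (λ x → x) ⟩
    ∑W (suc n) f ∎
    where open ≡-Reasoning

  module Selection {d n} (P : Word d n → Bool) where

    selected : List (Word d n)
    selected = List.filter (λ w → P w Boolₚ.≟ true) (words d n)

    count : ℕ
    count = List.length selected

    enum : Fin count → Word d n
    enum = List.lookup selected

    enum-P : ∀ i → P (enum i) ≡ true
    enum-P i = proj₂ (∈-filter⁻ (λ w → P w Boolₚ.≟ true) {xs = words d n} (∈-lookup {xs = selected} i))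

    ind-enum : ∀ j i → ind (enum j) (enum i) ≡ δ j i
    ind-enum j i with j ≟ᶠ i
    ... | yes refl = ind-refl (enum j)
    ... | no  j≢i  = ind-≢ {u = enum j} {enum i}
                       (j≢i ∘ lookup-injective selected (Uniqueₚ.filter⁺ _ (words-unique d n)) j i)

    ∑-enum : ∀ (f : Word d n → ℤ) → ∑ count (f ∘ enum) ≡ ∑W n (λ w → (if P w then + 1 else + 0) * f w)
    ∑-enum f = trans (∑-lookup f selected) (trans (sumL-filter (words d n)) (sumL-words n _))
      where
      sumL-filter : ∀ ws → sumL f (List.filter (λ w → P w Boolₚ.≟ true) ws)
                           ≡ sumL (λ w → (if P w then + 1 else + 0) * f w) ws
      sumL-filter []       = refl
      sumL-filter (w ∷ ws) with P w
      ... | true  = cong₂ _+_ (sym (*-identityˡ (f w))) (sumL-filter ws)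
      ... | false = trans (sumL-filter ws) (sym (trans (cong (_+ rest) (*-zeroˡ (f w))) (+-identityˡ rest)))
        where rest = sumL (λ w → (if P w then + 1 else + 0) * f w) ws

module QuotientBasis (p : ℕ) {d m : ℕ} (inA : Fin d → Bool) (cf : Coeffs d m)
  (E : Echelon.EchelonBasis p inA (ρcoef cf))
  (ρ-A-A : ∀ k x y → inA x ≡ true → inA y ≡ true → Congruence._≈_ p (ρcoef cf k x y) (+ 0))
  (1≉0 : ¬ Congruence._≈_ p (+ 1) (+ 0)) where

  open Congruence p
  open IdealClosure p cf using (InIdeal-cong)
  open NormalForm p inA cf E ρ-A-A
  open Counting 1≉0

  module Normal (n : ℕ) = Enumeration.Selection (isNormal {n})
  open Normal using (count; enum; enum-P; ind-enum; ∑-enum)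

  normalBasis : ∀ n → Fin (count n) → Hom d n
  normalBasis n i = ind (enum n i)

  hilb≡count : ∀ n → hilb d m n ≡ + count n
  hilb≡count n = begin
    hilb d m n                     ≡⟨ proj₁ (hilb≡#normal n) ⟩
    ∑W n χ                         ≡⟨ ∑W-cong n (λ w → sym (*-identityʳ (χ w))) ⟩
    ∑W n (λ w → χ w * + 1)         ≡⟨ sym (∑-enum n (λ _ → + 1)) ⟩
    ∑ (count n) (λ _ → + 1)        ≡⟨ ∑-const (count n) (+ 1) ⟩
    + count n * + 1                ≡⟨ *-identityʳ (+ count n) ⟩
    + count n                      ∎
    where open ≡-Reasoning

  NFᴴ-lincomb : ∀ n (c : Fin (count n) → ℤ) z →
                NFᴴ (lincomb c (normalBasis n)) z ≡ ∑ (count n) (λ j → c j * ind (enum n j) z)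
  NFᴴ-lincomb n c z = begin
    ∑W n (λ w → ∑ (count n) (λ j → c j * ind (enum n j) w) * NF w z)
      ≡⟨ ∑W-cong n (λ w → ∑-*ʳ (count n) (λ j → c j * ind (enum n j) w) (NF w z)) ⟩
    ∑W n (λ w → ∑ (count n) (λ j → c j * ind (enum n j) w * NF w z))
      ≡⟨ ∑W-∑ n (count n) (λ w j → c j * ind (enum n j) w * NF w z) ⟩
    ∑ (count n) (λ j → ∑W n (λ w → c j * ind (enum n j) w * NF w z))
      ≡⟨ ∑-cong (count n) (λ j → trans (∑W-cong n (λ w → *-assoc (c j) (ind (enum n j) w) (NF w z)))
                                        (sym (∑W-*ˡ n (c j) (λ w → ind (enum n j) w * NF w z)))) ⟩
    ∑ (count n) (λ j → c j * ∑W n (λ w → ind (enum n j) w * NF w z))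
      ≡⟨ ∑-cong (count n) (λ j → cong (c j *_) (trans (∑W-ind′ n (enum n j) (λ w → NF w z))
                                                      (NF-normal (enum n j) (enum-P n j) z))) ⟩
    ∑ (count n) (λ j → c j * ind (enum n j) z) ∎
    where open ≡-Reasoning

  -- NF vanishes on the ideal and is the identity on normal words.
  normalBasis-independent : ∀ n (c : Fin (count n) → ℤ) → InIdeal p cf (lincomb c (normalBasis n)) →
                            ∀ i → c i ≡[mod p ] + 0
  normalBasis-independent n c c∈I i = toMod (begin
    c i                                                ≡⟨ sym (∑-δ (count n) i c) ⟩
    ∑ (count n) (λ j → δ j i * c j)
      ≡⟨ ∑-cong (count n) (λ j → trans (cong (_* c j) (sym (ind-enum n j i))) (*-comm _ (c j))) ⟩
    ∑ (count n) (λ j → c j * ind (enum n j) (enum n i)) ≡⟨ sym (NFᴴ-lincomb n c (enum n i)) ⟩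
    NFᴴ (lincomb c (normalBasis n)) (enum n i)         ≈⟨ NFᴴ-ideal≈0 (lincomb c (normalBasis n)) c∈I (enum n i) ⟩
    + 0                                                ∎)
    where open ≈-Reasoning

  NF-expansion : ∀ {n} (w : Word d n) z → ∑ (count n) (λ i → NF w (enum n i) * ind (enum n i) z) ≈ NF w z
  NF-expansion {n} w z = begin
    ∑ (count n) (λ i → NF w (enum n i) * ind (enum n i) z)  ≡⟨ ∑-enum n (λ u → NF w u * ind u z) ⟩
    ∑W n (λ u → χ u * (NF w u * ind u z))                   ≡⟨ ∑W-cong n (λ u → lemma (χ u) (NF w u) (ind u z)) ⟩
    ∑W n (λ u → ind u z * (χ u * NF w u))                   ≡⟨ ∑W-ind n z (λ u → χ u * NF w u) ⟩
    χ z * NF w z                                            ≈⟨ χ-NF z ⟩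
    NF w z                                                  ∎
    where
    open ≈-Reasoning
    lemma : ∀ a b c → a * (b * c) ≡ c * (a * b)
    lemma = solve-∀
    χ-NF : ∀ z → χ z * NF w z ≈ NF w z
    χ-NF z with isNormal z in normal?
    ... | true  = ≈-reflexive (*-identityˡ (NF w z))
    ... | false = ≈-trans (≈-reflexive (*-zeroˡ (NF w z))) (≈-sym (NF-supported w z normal?))

  normalBasis-spans : ∀ n (f : Hom d n) →
                      ∃ λ (c : Fin (count n) → ℤ) → InIdeal p cf (λ w → f w - lincomb c (normalBasis n) w)
  normalBasis-spans n f =
    c , InIdeal-cong _ _ (λ z → -‿cong≈ (≈-refl {f z}) (≈-sym (lincomb≈NFᴴ z))) (f-NFᴴ∈I f)
    where
    c : Fin (count n) → ℤ
    c i = NFᴴ f (enum n i)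
    lemma : ∀ a b c → a * (b * c) ≡ b * (c * a)
    lemma = solve-∀
    lincomb≈NFᴴ : ∀ z → lincomb c (normalBasis n) z ≈ NFᴴ f z
    lincomb≈NFᴴ z = begin
      ∑ (count n) (λ i → ∑W n (λ w → f w * NF w (enum n i)) * ind (enum n i) z)
        ≡⟨ ∑-cong (count n) (λ i → trans (∑W-*ʳ n _ (ind (enum n i) z)) (∑W-cong n (λ w → *-assoc (f w) _ _))) ⟩
      ∑ (count n) (λ i → ∑W n (λ w → f w * (NF w (enum n i) * ind (enum n i) z)))
        ≡⟨ sym (∑W-∑ n (count n) (λ w i → f w * (NF w (enum n i) * ind (enum n i) z))) ⟩
      ∑W n (λ w → ∑ (count n) (λ i → f w * (NF w (enum n i) * ind (enum n i) z)))
        ≡⟨ ∑W-cong n (λ w → sym (∑-*ˡ (count n) (f w) (λ i → NF w (enum n i) * ind (enum n i) z))) ⟩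
      ∑W n (λ w → f w * ∑ (count n) (λ i → NF w (enum n i) * ind (enum n i) z))
        ≈⟨ ∑W-cong≈ n (λ w → *-congˡ≈ (f w) (NF-expansion w z)) ⟩
      NFᴴ f z ∎
      where open ≈-Reasoning

  stronglyFree : StronglyFree p d m cf
  stronglyFree n = count n , hilb≡count n , normalBasis n , normalBasis-independent n , normalBasis-spans n

module Hypotheses (p : ℕ) {d m : ℕ} (inA : Fin d → Bool) (cf : Coeffs d m) where
  open Congruence p
  open Echelon p inA

  sign< : Fin d → Fin d → ℤ
  sign< a b = if does (a <? b) then + 1 else - + 1

  private
    <ᵇ-true : ∀ (a b : Fin d) → (toℕ a ℕ.<ᵇ toℕ b) ≡ true → a < b
    <ᵇ-true a b eq = ℕ.<ᵇ⇒< (toℕ a) (toℕ b) (subst T (sym eq) _)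

    <ᵇ-false : ∀ (a b : Fin d) → (toℕ a ℕ.<ᵇ toℕ b) ≡ false → ¬ a < b
    <ᵇ-false a b eq a<b = subst T eq (ℕ.<⇒<ᵇ a<b)

  -- Data.Fin's _<?_ computes with _<ᵇ_, which is what the case split sees.
  entryML≡sign<*ρcoef : ∀ {a b} → inA a ≡ true → inA b ≡ false → ∀ k → entryML cf k a b ≡ sign< a b * ρcoef cf k a b
  entryML≡sign<*ρcoef {a} {b} a∈A b∈B k with toℕ a ℕ.<ᵇ toℕ b in a<ᵇb | toℕ b ℕ.<ᵇ toℕ a in b<ᵇa
  ... | true  | true  = ⊥-elim (ℕ.<-asym (<ᵇ-true a b a<ᵇb) (<ᵇ-true b a b<ᵇa))
  ... | true  | false = sym (trans (*-identityˡ _) (+-identityʳ _))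
  ... | false | true  = lemma (cf b a k)
    where lemma : ∀ x → x ≡ - + 1 * (+ 0 - x)
          lemma = solve-∀
  ... | false | false = ⊥-elim (true≢false (trans (sym a∈A) (trans (cong inA a≡b) b∈B)))
    where
    a≡b : a ≡ b
    a≡b = FinP.toℕ-injective (ℕ.≤-antisym (ℕ.≮⇒≥ (<ᵇ-false b a b<ᵇa)) (ℕ.≮⇒≥ (<ᵇ-false a b a<ᵇb)))

  ρcoef-independent : FullRowRank p inA cf → LinearlyIndependentOnA×B (ρcoef cf)
  ρcoef-independent full-rank c c·ρ≈0 k = fromMod (full-rank c c·entryML≡0 k)
    where
    lemma : ∀ a b c → a * (b * c) ≡ b * (a * c)
    lemma = solve-∀
    c·entryML≡0 : ∀ a b → inA a ≡ true → inA b ≡ false → ∑ m (λ k → c k * entryML cf k a b) ≡[mod p ] + 0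
    c·entryML≡0 a b a∈A b∈B = toMod (begin
      ∑ m (λ k → c k * entryML cf k a b)
        ≡⟨ ∑-cong m (λ k → trans (cong (c k *_) (entryML≡sign<*ρcoef a∈A b∈B k))
                                 (lemma (c k) (sign< a b) (ρcoef cf k a b))) ⟩
      ∑ m (λ k → sign< a b * (c k * ρcoef cf k a b))
        ≡⟨ sym (∑-*ˡ m (sign< a b) (λ k → c k * ρcoef cf k a b)) ⟩
      sign< a b * ∑ m (λ k → c k * ρcoef cf k a b)
        ≈⟨ *-≈0ʳ (sign< a b) (c·ρ≈0 a b a∈A b∈B) ⟩
      + 0 ∎)
      where open ≈-Reasoning

  ρcoef-A-A : (∀ i j k → i < j → inA i ≡ true → inA j ≡ true → cf i j k ≡[mod p ] + 0) →
              ∀ k x y → inA x ≡ true → inA y ≡ true → ρcoef cf k x y ≈ + 0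
  ρcoef-A-A cf-A-A k x y x∈A y∈A = -‿cong≈ (when<≈0 x y x∈A y∈A) (when<≈0 y x y∈A x∈A)
    where
    when<≈0 : ∀ x y → inA x ≡ true → inA y ≡ true → when< x y (cf x y k) ≈ + 0
    when<≈0 x y x∈A y∈A with toℕ x ℕ.<ᵇ toℕ y in x<ᵇy
    ... | true  = fromMod (cf-A-A x y k (<ᵇ-true x y x<ᵇy) x∈A y∈A)
    ... | false = ≈-refl

corollary7 : (p d m : ℕ) → Prime p → (inA : Fin d → Bool) →
    (∃ λ i → inA i ≡ true) → (∃ λ j → inA j ≡ false) →
    (cf : Coeffs d m) →
    (∀ i j k → i < j → inA i ≡ true → inA j ≡ true → cf i j k ≡[mod p ] + 0) →
    FullRowRank p inA cf →
    StronglyFree p d m cf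
-- A and B need not be non-empty: if either is empty, M_L has no columns and
-- full rank forces m = 0.
corollary7 p d m p-prime inA _ _ cf cf-A-A full-rank =
  QuotientBasis.stronglyFree p inA cf echelon (ρcoef-A-A cf-A-A) (InverseModPrime.1≉0 p p-prime)
  where
  open Hypotheses p inA cf
  echelon : Echelon.EchelonBasis p inA (ρcoef cf)
  echelon = GaussianElimination.echelonBasis p p-prime inA (ρcoef cf) (ρcoef-independent full-rank)
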